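{- Let $G$ be an $n$-vertex graph with a vertex $w$ that is the anchor vertex of two pendant paths $u_1u_2\cdots u_sw$ and $v_1v_2\cdots v_tw$ (with all of $u_1,\dots,u_s,v_1,\dots,v_t,w$ distinct). If $n-s-t\ge 14$ and $\frac{8}{n-s-t}\le p<1$, then \[\Pr[B_p(G)\in\mathrm{ZFS}(G)]<\Pr[B_p(P_n)\in\mathrm{ZFS}(P_n)].\]
   Context: All graphs are finite and simple; $P_n$ is the path on $n$ vertices; $d_G(v)$ is the degree of $v$. A path $x_1x_2\cdots x_k$ in $G$ is a pendant path if $k\ge 2$, $d_G(x_1)=1$, $d_G(x_i)=2$ for $1<i<k$, and $d_G(x_k)>2$; $x_k$ is its anchor vertex. Zero forcing: given a graph $G$ whose vertices are each colored blue or white, if a blue vertex $u$ has exactly one white neighbor $v$, then $v$ may be recolored blue; this rule is applied repeatedly. A set $B\subseteq V(G)$ is a zero forcing set of $G$ if, starting with exactly the vertices of $B$ blue, repeated application eventually colors all of $V(G)$ blue. $\mathrm{ZFS}(G)$ is the set of zero forcing sets of $G$. For $p\in[0,1]$, $B_p(G)$ is the random subset of $V(G)$ containing each vertex independently with probability $p$.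
   Formalization: The parameter p ranges only over the rational numbers. -}

module Defs where

open import Data.Nat using (ℕ; zero; suc; _+_; _∸_; _≤_; _<_; _≡ᵇ_)

open import Data.Bool using (Bool; true; false; if_then_else_; _∨_)
open import Data.Bool.Properties using (∨-comm)
open import Data.Fin using (Fin; toℕ)
open import Data.Fin.Subset using (Subset; _∈_; _∉_; _∪_; ⁅_⁆; ∣_∣)
open import Data.Vec using (Vec; []; _∷_)
open import Data.List using (List; []; _∷_; _++_; map; foldr; allFin)
open import Data.Nat.ListAction using (sum)
open import Data.Product using (_×_; ∃)
open import Data.Integer using (+_)
open import Data.Rational using (ℚ; 0ℚ; 1ℚ; _*_; _-_; _/_) renaming (_+_ to _+ℚ_)
open import Function.Definitions using (Injective)
open import Relation.Binary.PropositionalEquality using (_≡_; _≢_; refl)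
open import Relation.Binary.Construct.Closure.ReflexiveTransitive using (Star)

record Graph (n : ℕ) : Set where
  field
    adj    : Fin n → Fin n → Bool
    sym    : ∀ i j → adj i j ≡ adj j i
    irrefl : ∀ i → adj i i ≡ false
open Graph public

Adj : ∀ {n} → Graph n → Fin n → Fin n → Set
Adj G u v = adj G u v ≡ true

deg : ∀ {n} → Graph n → Fin n → ℕ
deg {n} G v = sum (map (λ u → if adj G v u then 1 else 0) (allFin n))

private
  adjP : ∀ {n} → Fin n → Fin n → Bool
  adjP i j = (suc (toℕ i) ≡ᵇ toℕ j) ∨ (suc (toℕ j) ≡ᵇ toℕ i)

  sb-false : ∀ m → (suc m ≡ᵇ m) ≡ false
  sb-false zero = refl
  sb-false (suc m) = sb-false m

  adjP-irrefl : ∀ {n} (i : Fin n) → adjP i i ≡ false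
  adjP-irrefl i rewrite sb-false (toℕ i) = refl

Path : (n : ℕ) → Graph n
Path n = record
  { adj    = adjP
  ; sym    = λ i j → ∨-comm (suc (toℕ i) ≡ᵇ toℕ j) (suc (toℕ j) ≡ᵇ toℕ i)
  ; irrefl = adjP-irrefl
  }

-- Pendant paths.  A path x₁ x₂ ⋯ x_k is given by x : Fin k → Fin n
-- (x i is the vertex x_{i+1}).

record IsPendantPath {n : ℕ} (G : Graph n) (k : ℕ) (x : Fin k → Fin n) : Set where
  field
    two≤k     : 2 ≤ k
    distinct  : Injective _≡_ _≡_ x
    consec    : ∀ (i j : Fin k) → toℕ j ≡ suc (toℕ i) → Adj G (x i) (x j)
    first     : ∀ (i : Fin k) → toℕ i ≡ 0 → deg G (x i) ≡ 1
    interior  : ∀ (i : Fin k) → 0 < toℕ i → suc (toℕ i) < k → deg G (x i) ≡ 2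
    last      : ∀ (i : Fin k) → suc (toℕ i) ≡ k → 2 < deg G (x i)

IsAnchor : ∀ {n k} → (Fin k → Fin n) → Fin n → Set
IsAnchor {k = k} x w = ∀ (i : Fin k) → suc (toℕ i) ≡ k → x i ≡ w

-- Zero forcing.  A colouring is the set B of blue vertices.

data Force {n : ℕ} (G : Graph n) : Subset n → Subset n → Set where
  force : ∀ {B} (u v : Fin n) →
          u ∈ B → v ∉ B → Adj G u v →
          (∀ x → Adj G u x → x ≢ v → x ∈ B) →
          Force G B (B ∪ ⁅ v ⁆)

IsZFS : ∀ {n} → Graph n → Subset n → Set
IsZFS {n} G B = ∃ λ B' → Star (Force G) B B' × (∀ v → v ∈ B')

_^ℚ_ : ℚ → ℕ → ℚ
p ^ℚ zero  = 1ℚ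
p ^ℚ suc k = p * (p ^ℚ k)

allSubsets : (n : ℕ) → List (Subset n)
allSubsets zero    = [] ∷ []
allSubsets (suc n) = map (true ∷_) (allSubsets n) ++ map (false ∷_) (allSubsets n)

Indicates : ∀ {n} → (Subset n → Bool) → (Subset n → Set) → Set
Indicates {n} χ P = ∀ (B : Subset n) → (χ B ≡ true → P B) × (P B → χ B ≡ true)

ProbOf : (n : ℕ) → (Subset n → Bool) → ℚ → ℚ
ProbOf n χ p =
  foldr _+ℚ_ 0ℚ
    (map (λ B → if χ B then (p ^ℚ ∣ B ∣) * ((1ℚ - p) ^ℚ (n ∸ ∣ B ∣)) else 0ℚ)
         (allSubsets n))

8/ : ℕ → ℚ
8/ zero    = 0ℚ
8/ (suc m) = + 8 / suc m

-- Write q = 1 - p and call a bit string spaced when no two consecutive entries are 1.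
-- If the colouring B is spaced, with both end entries 0, along each leg u₁ ⋯ u_s and
-- v₁ ⋯ v_t, then no leg vertex is ever forced: a blue leg vertex has two white leg
-- neighbours, and w has the two white neighbours u_s and v_t.  The legs are disjoint, so
-- Pr[B_p(G) ∈ ZFS(G)] ≤ 1 - f(s) f(t), where f(k) is the probability that a random string
-- of length k is spaced with both end entries 0.  Conversely, a colouring of P_n without
-- this property has a blue end or two adjacent blue vertices, from which P_n is swept
-- blue, so Pr[B_p(P_n) ∈ ZFS(P_n)] ≥ 1 - f(n).
-- It remains to show f(n) < f(s) f(t).  With h(k) and τ(k) the probabilities of being
-- spaced, resp. spaced with last entry 0, we have f(k + 1) = q τ(k) and q h(k) ≤ τ(k);
-- cutting a string of length n - 1 into blocks of lengths s - 1, m = n - s - t + 1 and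
-- t - 1 gives f(n) ≤ q h(s - 1) h(m) τ(t - 1), so h(m) < q² suffices.  Blocks of length
-- two give h(m) ≤ (1 - p²)^⌊m/2⌋, and (1 - p²)^(2+c) = (1 - p)² (1 + p)² (1 - p²)^c < (1 - p)²
-- by Bernoulli's inequality as soon as (c - 1) p > 2, which (n - s - t) p ≥ 8 ensures.

module Submission where

open import Defs hiding (sym)
open import Data.Bool using (Bool; true; false; T; if_then_else_; _∧_)
open import Data.Bool.Properties as Bool using ()
open import Data.Empty using (⊥; ⊥-elim)
open import Data.Fin as Fin using (Fin; toℕ; fromℕ<; punchIn; punchOut; splitAt)
open import Data.Fin.Properties as Fin using (any?; _≟_)
open import Data.Fin.Subset using (Subset; _∈_; _∉_; _∪_; ⁅_⁆; ∣_∣)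
open import Data.Fin.Subset.Properties as Subset using (∣p∣≤n)
open import Data.Integer as ℤ using (+_)
open import Data.Integer.Properties as ℤ using ()
open import Data.List as List using (List)
open import Data.List.Properties as List using ()
open import Data.Nat as ℕ using (ℕ; zero; suc; _∸_; z≤n; s≤s; _≡ᵇ_; ⌈_/2⌉)
open import Data.Nat.ListAction using (sum)
open import Data.Nat.Properties as ℕ using ()
open import Data.Nat.Tactic.RingSolver using () renaming (ring to ℕ-ring)
open import Data.Product using (_,_; _×_; ∃; proj₁; proj₂)
open import Data.Rational
  using (ℚ; 0ℚ; 1ℚ; _+_; _*_; _-_; -_; _/_; _≤_; _<_; positive; nonNegative; toℚᵘ)
open import Data.Rational.Properties as ℚ using (+-*-commutativeRing)
open import Data.Rational.Unnormalised as ℚᵘ using (mkℚᵘ; *≡*)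
open import Data.Rational.Unnormalised.Properties as ℚᵘ using ()
open import Data.Sum using (_⊎_; inj₁; inj₂; [_,_]′)
open import Data.Vec as Vec using (Vec; []; _∷_; _++_; lookup; tabulate; insertAt; take; drop)
open import Data.Vec.Properties as Vec using ()
open import Function using (_∘_; id)
open import Function.Definitions using (Injective)
open import Relation.Binary.Construct.Closure.ReflexiveTransitive using (Star; ε; _◅_; _◅◅_)
open import Relation.Binary.PropositionalEquality
open import Relation.Nullary using (yes; no; ¬_)
open import Relation.Nullary.Decidable using (dec⇒maybe)
open import Tactic.RingSolver using (solve-∀)
open import Tactic.RingSolver.Core.AlmostCommutativeRing using (AlmostCommutativeRing; fromCommutativeRing)

ℚ-ring : AlmostCommutativeRing _ _
ℚ-ring = fromCommutativeRing +-*-commutativeRing (λ x → dec⇒maybe (ℚ._≟_ 0ℚ x))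

p≤q⇒0≤q-p : ∀ {p q} → p ≤ q → 0ℚ ≤ q - p
p≤q⇒0≤q-p {p} p≤q = ℚ.≤-trans (ℚ.≤-reflexive (sym (ℚ.+-inverseʳ p))) (ℚ.+-monoˡ-≤ (- p) p≤q)

p<q⇒0<q-p : ∀ {p q} → p < q → 0ℚ < q - p
p<q⇒0<q-p {p} p<q = ℚ.≤-<-trans (ℚ.≤-reflexive (sym (ℚ.+-inverseʳ p))) (ℚ.+-monoˡ-< (- p) p<q)

0≤*0≤⇒0≤* : ∀ {p q} → 0ℚ ≤ p → 0ℚ ≤ q → 0ℚ ≤ p * q
0≤*0≤⇒0≤* {p} {q} 0≤p 0≤q =
  ℚ.nonNegative⁻¹ _ {{ℚ.nonNeg*nonNeg⇒nonNeg p {{nonNegative 0≤p}} q {{nonNegative 0≤q}}}}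

0<*0<⇒0<* : ∀ {p q} → 0ℚ < p → 0ℚ < q → 0ℚ < p * q
0<*0<⇒0<* {p} {q} 0<p 0<q =
  ℚ.positive⁻¹ _ {{ℚ.pos*pos⇒pos p {{positive 0<p}} q {{positive 0<q}}}}

^ℚ-nonNeg : ∀ {x} → 0ℚ ≤ x → ∀ k → 0ℚ ≤ x ^ℚ k
^ℚ-nonNeg 0≤x zero    = ℚ.<⇒≤ (ℚ.positive⁻¹ 1ℚ)
^ℚ-nonNeg 0≤x (suc k) = 0≤*0≤⇒0≤* 0≤x (^ℚ-nonNeg 0≤x k)

^ℚ-pos : ∀ {x} → 0ℚ < x → ∀ k → 0ℚ < x ^ℚ k
^ℚ-pos 0<x zero    = ℚ.positive⁻¹ 1ℚ
^ℚ-pos 0<x (suc k) = 0<*0<⇒0<* 0<x (^ℚ-pos 0<x k)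

ι : ℕ → ℚ
ι n = + n / 1

ι-suc : ∀ n → ι (suc n) ≡ 1ℚ + ι n
ι-suc n = ℚ.toℚᵘ-injective (begin
  toℚᵘ (ι (suc n))           ≈⟨ ℚ.toℚᵘ-fromℚᵘ (mkℚᵘ (+ suc n) 0) ⟩
  mkℚᵘ (+ suc n) 0           ≈⟨ *≡* (cong (ℤ._* + 1) 1*1+n*1≡1+n) ⟨
  toℚᵘ 1ℚ ℚᵘ.+ mkℚᵘ (+ n) 0  ≈⟨ ℚᵘ.+-congʳ (toℚᵘ 1ℚ) (ℚ.toℚᵘ-fromℚᵘ (mkℚᵘ (+ n) 0)) ⟨
  toℚᵘ 1ℚ ℚᵘ.+ toℚᵘ (ι n)    ≈⟨ ℚ.toℚᵘ-homo-+ 1ℚ (ι n) ⟨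
  toℚᵘ (1ℚ + ι n)            ∎)
  where
  open ℚᵘ.≃-Reasoning
  1*1+n*1≡1+n : + 1 ℤ.* + 1 ℤ.+ + n ℤ.* + 1 ≡ + suc n
  1*1+n*1≡1+n = cong₂ ℤ._+_ (ℤ.*-identityʳ (+ 1)) (ℤ.*-identityʳ (+ n))

/-*-cancel : ∀ a d → (+ a / suc d) * ι (suc d) ≡ ι a
/-*-cancel a d = ℚ.toℚᵘ-injective (begin
  toℚᵘ ((+ a / suc d) * ι (suc d))          ≈⟨ ℚ.toℚᵘ-homo-* (+ a / suc d) (ι (suc d)) ⟩
  toℚᵘ (+ a / suc d) ℚᵘ.* toℚᵘ (ι (suc d))  ≈⟨ ℚᵘ.*-cong (ℚ.toℚᵘ-fromℚᵘ (mkℚᵘ (+ a) d))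
                                                          (ℚ.toℚᵘ-fromℚᵘ (mkℚᵘ (+ suc d) 0)) ⟩
  mkℚᵘ (+ a) d ℚᵘ.* mkℚᵘ (+ suc d) 0        ≈⟨ *≡* cross-multiplied ⟩
  mkℚᵘ (+ a) 0                              ≈⟨ ℚ.toℚᵘ-fromℚᵘ (mkℚᵘ (+ a) 0) ⟨
  toℚᵘ (ι a)                                ∎)
  where
  open ℚᵘ.≃-Reasoning
  cross-multiplied : (+ a ℤ.* + suc d) ℤ.* + 1 ≡ + a ℤ.* + suc (d ℕ.* 1)
  cross-multiplied rewrite ℕ.*-identityʳ d = ℤ.*-identityʳ (+ a ℤ.* + suc d)

ι-+ : ∀ a b → ι (a ℕ.+ b) ≡ ι a + ι b
ι-+ zero    b = sym (ℚ.+-identityˡ (ι b))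
ι-+ (suc a) b rewrite ι-suc (a ℕ.+ b) | ι-+ a b | ι-suc a = sym (ℚ.+-assoc 1ℚ (ι a) (ι b))

ι-nonNeg : ∀ n → 0ℚ ≤ ι n
ι-nonNeg n = ℚ.nonNegative⁻¹ (ι n) {{ℚ.normalize-nonNeg n 1}}

ι-mono : ∀ {a b} → a ℕ.≤ b → ι a ≤ ι b
ι-mono {a} a≤b with ℕ.m≤n⇒∃[o]m+o≡n a≤b
... | d , refl = begin
  ι a          ≡⟨ ℚ.+-identityʳ (ι a) ⟨
  ι a + 0ℚ     ≤⟨ ℚ.+-monoʳ-≤ (ι a) (ι-nonNeg d) ⟩
  ι a + ι d    ≡⟨ ι-+ a d ⟨
  ι (a ℕ.+ d)  ∎
  where open ℚ.≤-Reasoning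

8/-lower-bound : ∀ m {p} → 8/ (suc m) ≤ p → 0ℚ < p × ι 8 ≤ ι (suc m) * p
8/-lower-bound m {p} 8/[1+m]≤p =
  ℚ.<-≤-trans (ℚ.positive⁻¹ (+ 8 / suc m) {{ℚ.normalize-pos 8 (suc m)}}) 8/[1+m]≤p , (begin
    ι 8                        ≡⟨ /-*-cancel 8 m ⟨
    (+ 8 / suc m) * ι (suc m)  ≤⟨ ℚ.*-monoʳ-≤-nonNeg (ι (suc m)) {{nonNegative (ι-nonNeg (suc m))}} 8/[1+m]≤p ⟩
    p * ι (suc m)              ≡⟨ ℚ.*-comm p (ι (suc m)) ⟩
    ι (suc m) * p              ∎)
  where open ℚ.≤-Reasoning

bernoulli-inequality : ∀ {y} → 0ℚ ≤ y → y ≤ 1ℚ → ∀ j → ((1ℚ - y) ^ℚ j) * (1ℚ + ι j * y) ≤ 1ℚ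
bernoulli-inequality {y} 0≤y y≤1 zero    = ℚ.≤-reflexive (unit y)
  where
  unit : ∀ y → 1ℚ * (1ℚ + 0ℚ * y) ≡ 1ℚ
  unit = solve-∀ ℚ-ring
bernoulli-inequality {y} 0≤y y≤1 (suc j) = begin
  ((1ℚ - y) ^ℚ suc j) * (1ℚ + ι (suc j) * y)     ≡⟨ cong (λ z → ((1ℚ - y) ^ℚ suc j) * (1ℚ + z * y)) (ι-suc j) ⟩
  ((1ℚ - y) * g) * (1ℚ + (1ℚ + ι j) * y)         ≡⟨ expand y g (ι j) ⟩
  g * (1ℚ + ι j * y) - g * ((1ℚ + ι j) * y * y)  ≤⟨ ℚ.+-monoʳ-≤ (g * (1ℚ + ι j * y)) (ℚ.neg-antimono-≤ 0≤loss) ⟩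
  g * (1ℚ + ι j * y) - 0ℚ                        ≡⟨ ℚ.+-identityʳ _ ⟩
  g * (1ℚ + ι j * y)                             ≤⟨ bernoulli-inequality 0≤y y≤1 j ⟩
  1ℚ                                             ∎
  where
  open ℚ.≤-Reasoning
  g : ℚ
  g = (1ℚ - y) ^ℚ j
  expand : ∀ y g J → ((1ℚ - y) * g) * (1ℚ + (1ℚ + J) * y) ≡ g * (1ℚ + J * y) - g * ((1ℚ + J) * y * y)
  expand = solve-∀ ℚ-ring
  0≤loss : 0ℚ ≤ g * ((1ℚ + ι j) * y * y)
  0≤loss = 0≤*0≤⇒0≤* (^ℚ-nonNeg (p≤q⇒0≤q-p y≤1) j)
             (0≤*0≤⇒0≤* (0≤*0≤⇒0≤* (subst (0ℚ ≤_) (ι-suc j) (ι-nonNeg (suc j))) 0≤y) 0≤y)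

[1-x²]^[2+c]<[1-x]² : ∀ {x} c → 0ℚ < x → x < 1ℚ → ι 2 + x < ι c * x →
                      (1ℚ - x * x) ^ℚ (2 ℕ.+ c) < (1ℚ - x) * (1ℚ - x)
[1-x²]^[2+c]<[1-x]² {x} c 0<x x<1 gap = begin-strict
  (1ℚ - x * x) ^ℚ (2 ℕ.+ c)                          ≡⟨ factor x G ⟩
  (1ℚ - x) * (1ℚ - x) * (G * ((1ℚ + x) * (1ℚ + x)))  <⟨ ℚ.*-monoʳ-<-pos ((1ℚ - x) * (1ℚ - x))
                                                          {{positive (0<*0<⇒0<* 0<1-x 0<1-x)}} G[1+x]²<1 ⟩
  (1ℚ - x) * (1ℚ - x) * 1ℚ                           ≡⟨ ℚ.*-identityʳ _ ⟩
  (1ℚ - x) * (1ℚ - x)                                ∎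
  where
  open ℚ.≤-Reasoning
  G : ℚ
  G = (1ℚ - x * x) ^ℚ c
  factor : ∀ x G → (1ℚ - x * x) * ((1ℚ - x * x) * G) ≡ (1ℚ - x) * (1ℚ - x) * (G * ((1ℚ + x) * (1ℚ + x)))
  factor = solve-∀ ℚ-ring
  0<1-x : 0ℚ < 1ℚ - x
  0<1-x = p<q⇒0<q-p x<1
  x²<1 : x * x < 1ℚ
  x²<1 = ℚ.<-trans (ℚ.<-≤-trans (ℚ.*-monoˡ-<-pos x {{positive 0<x}} x<1) (ℚ.≤-reflexive (ℚ.*-identityˡ x))) x<1
  [1+x]²<1+cx² : (1ℚ + x) * (1ℚ + x) < 1ℚ + ι c * (x * x)
  [1+x]²<1+cx² = begin-strict
    (1ℚ + x) * (1ℚ + x)                              ≡⟨ ℚ.+-identityʳ _ ⟨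
    (1ℚ + x) * (1ℚ + x) + 0ℚ                         <⟨ ℚ.+-monoʳ-< ((1ℚ + x) * (1ℚ + x))
                                                          (0<*0<⇒0<* 0<x (p<q⇒0<q-p gap)) ⟩
    (1ℚ + x) * (1ℚ + x) + x * (ι c * x - (ι 2 + x))  ≡⟨ expand x (ι c) ⟩
    1ℚ + ι c * (x * x)                               ∎
    where
    expand : ∀ x C → (1ℚ + x) * (1ℚ + x) + x * (C * x - ((1ℚ + 1ℚ) + x)) ≡ 1ℚ + C * (x * x)
    expand = solve-∀ ℚ-ring
  G[1+x]²<1 : G * ((1ℚ + x) * (1ℚ + x)) < 1ℚ
  G[1+x]²<1 = ℚ.<-≤-trans (ℚ.*-monoʳ-<-pos G {{positive (^ℚ-pos (p<q⇒0<q-p x²<1) c)}} [1+x]²<1+cx²)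
                (bernoulli-inequality (0≤*0≤⇒0≤* (ℚ.<⇒≤ 0<x) (ℚ.<⇒≤ 0<x)) (ℚ.<⇒≤ x²<1) c)

8≤[14+2e]x⇒2+x<[5+e]x : ∀ {x} e → 0ℚ ≤ x → ι 8 ≤ ι (14 ℕ.+ (e ℕ.+ e)) * x → ι 2 + x < ι (5 ℕ.+ e) * x
8≤[14+2e]x⇒2+x<[5+e]x {x} e 0≤x 8≤[14+2e]x = ℚ.*-cancelˡ-<-nonNeg (ι 7) {{ℚ.normalize-nonNeg 7 1}} (begin-strict
  ι 7 * (ι 2 + x)                                  ≡⟨ ℚ.+-identityʳ _ ⟨
  ι 7 * (ι 2 + x) + 0ℚ                             <⟨ ℚ.+-monoʳ-< (ι 7 * (ι 2 + x)) 0<slack ⟩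
  ι 7 * (ι 2 + x) + (ι 2 * D + ι 3 * E * x + ι 2)  ≡⟨ regroup E x ⟩
  ι 7 * ((ι 5 + E) * x)                            ≡⟨ cong (λ z → ι 7 * (z * x)) (ι-+ 5 e) ⟨
  ι 7 * (ι (5 ℕ.+ e) * x)                          ∎)
  where
  open ℚ.≤-Reasoning
  E D : ℚ
  E = ι e
  D = (ι 14 + (E + E)) * x - ι 8
  0≤D : 0ℚ ≤ D
  0≤D = p≤q⇒0≤q-p (subst (λ z → ι 8 ≤ z * x) (trans (ι-+ 14 (e ℕ.+ e)) (cong (_+_ (ι 14)) (ι-+ e e))) 8≤[14+2e]x)
  0<slack : 0ℚ < ι 2 * D + ι 3 * E * x + ι 2
  0<slack = ℚ.+-mono-≤-<
    (ℚ.+-mono-≤ (0≤*0≤⇒0≤* (ι-nonNeg 2) 0≤D) (0≤*0≤⇒0≤* (0≤*0≤⇒0≤* (ι-nonNeg 3) (ι-nonNeg e)) 0≤x))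
    (ℚ.positive⁻¹ (ι 2))
  regroup : ∀ E x → ι 7 * (ι 2 + x) + (ι 2 * ((ι 14 + (E + E)) * x - ι 8) + ι 3 * E * x + ι 2)
                    ≡ ι 7 * ((ι 5 + E) * x)
  regroup = solve-∀ ℚ-ring

⌈n/2⌉-bounds : ∀ n → n ℕ.≤ ⌈ n /2⌉ ℕ.+ ⌈ n /2⌉ × ⌈ n /2⌉ ℕ.+ ⌈ n /2⌉ ℕ.≤ suc n
⌈n/2⌉-bounds n =
  ℕ.≤-trans (ℕ.≤-reflexive (sym (ℕ.⌊n/2⌋+⌈n/2⌉≡n n))) (ℕ.+-monoˡ-≤ ⌈ n /2⌉ (ℕ.⌊n/2⌋≤⌈n/2⌉ n)) ,
  ℕ.≤-trans (ℕ.+-monoʳ-≤ ⌈ n /2⌉ (ℕ.⌊n/2⌋≤⌈n/2⌉ (suc n))) (ℕ.≤-reflexive (ℕ.⌊n/2⌋+⌈n/2⌉≡n (suc n)))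

sumℚ : List ℚ → ℚ
sumℚ = List.foldr _+_ 0ℚ

sumℚ-++ : ∀ xs ys → sumℚ (xs List.++ ys) ≡ sumℚ xs + sumℚ ys
sumℚ-++ List.[]       ys = sym (ℚ.+-identityˡ (sumℚ ys))
sumℚ-++ (x List.∷ xs) ys rewrite sumℚ-++ xs ys = sym (ℚ.+-assoc x (sumℚ xs) (sumℚ ys))

sumℚ-*ˡ : ∀ c xs → sumℚ (List.map (c *_) xs) ≡ c * sumℚ xs
sumℚ-*ˡ c List.[]       = sym (ℚ.*-zeroʳ c)
sumℚ-*ˡ c (x List.∷ xs) rewrite sumℚ-*ˡ c xs = sym (ℚ.*-distribˡ-+ c x (sumℚ xs))

𝟙 : Bool → ℚ
𝟙 true  = 1ℚ
𝟙 false = 0ℚ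

𝟙-nonNeg : ∀ b → 0ℚ ≤ 𝟙 b
𝟙-nonNeg true  = ℚ.<⇒≤ (ℚ.positive⁻¹ 1ℚ)
𝟙-nonNeg false = ℚ.≤-refl

𝟙≤1 : ∀ b → 𝟙 b ≤ 1ℚ
𝟙≤1 true  = ℚ.≤-refl
𝟙≤1 false = ℚ.<⇒≤ (ℚ.positive⁻¹ 1ℚ)

𝟙-mono : ∀ {a b} → (a ≡ true → b ≡ true) → 𝟙 a ≤ 𝟙 b
𝟙-mono {true}  a⇒b rewrite a⇒b refl = ℚ.≤-refl
𝟙-mono {false} {b} _ = 𝟙-nonNeg b

𝟙-∧ : ∀ a b → 𝟙 (a ∧ b) ≡ 𝟙 a * 𝟙 b
𝟙-∧ true  b = sym (ℚ.*-identityˡ (𝟙 b))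
𝟙-∧ false b = sym (ℚ.*-zeroˡ (𝟙 b))

restrict : ∀ {k n} → (Fin k → Fin n) → Subset n → Subset k
restrict φ B = tabulate (lookup B ∘ φ)

tabulate-insertAt : ∀ {A : Set} {k} (g : Fin (suc k) → A) (i : Fin (suc k)) →
                    tabulate g ≡ insertAt (tabulate (g ∘ punchIn i)) i (g i)
tabulate-insertAt             g Fin.zero    = refl
tabulate-insertAt {k = suc k} g (Fin.suc i) = cong (g Fin.zero ∷_) (tabulate-insertAt (g ∘ Fin.suc) i)

take-drop-++ : ∀ {A : Set} {m n} (xs : Vec A m) (ys : Vec A n) →
               take m (xs ++ ys) ≡ xs × drop m (xs ++ ys) ≡ ys
take-drop-++ {m = m} xs ys = Vec.++-injective (take m (xs ++ ys)) xs (Vec.take++drop≡id m (xs ++ ys))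

restrict-++ : ∀ {n s t} (f : Fin s → Fin n) (g : Fin t → Fin n) (B : Subset n) →
              restrict ([ f , g ]′ ∘ splitAt s) B ≡ restrict f B ++ restrict g B
restrict-++ {s = s} f g B = trans (Vec.tabulate-cong pointwise) (Vec.tabulate∘lookup _)
  where
  pointwise : ∀ i → lookup B ([ f , g ]′ (splitAt s i)) ≡ lookup (restrict f B ++ restrict g B) i
  pointwise i rewrite Vec.lookup-splitAt s (restrict f B) (restrict g B) i with splitAt s i
  ... | inj₁ j = sym (Vec.lookup∘tabulate _ j)
  ... | inj₂ j = sym (Vec.lookup∘tabulate _ j)

[,]∘splitAt-injective : ∀ {n s t} {f : Fin s → Fin n} {g : Fin t → Fin n} →
  Injective _≡_ _≡_ f → Injective _≡_ _≡_ g → (∀ i j → f i ≢ g j) → Injective _≡_ _≡_ ([ f , g ]′ ∘ splitAt s)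
[,]∘splitAt-injective {s = s} {t} {f} {g} f-inj g-inj f≢g {a} {b} e = begin
  a                          ≡⟨ Fin.join-splitAt s t a ⟨
  Fin.join s t (splitAt s a) ≡⟨ cong (Fin.join s t) ([,]-injective (splitAt s a) (splitAt s b) e) ⟩
  Fin.join s t (splitAt s b) ≡⟨ Fin.join-splitAt s t b ⟩
  b                          ∎
  where
  open ≡-Reasoning
  [,]-injective : ∀ x y → [ f , g ]′ x ≡ [ f , g ]′ y → x ≡ y
  [,]-injective (inj₁ i) (inj₁ j) e = cong inj₁ (f-inj e)
  [,]-injective (inj₁ i) (inj₂ j) e = ⊥-elim (f≢g i j e)
  [,]-injective (inj₂ i) (inj₁ j) e = ⊥-elim (f≢g j i (sym e))
  [,]-injective (inj₂ i) (inj₂ j) e = cong inj₂ (g-inj e)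

-- The product Bernoulli measure

module Bernoulli (p : ℚ) where

  q : ℚ
  q = 1ℚ - p

  𝔼 : (n : ℕ) → (Subset n → ℚ) → ℚ
  𝔼 zero    f = f []
  𝔼 (suc n) f = p * 𝔼 n (f ∘ (true ∷_)) + q * 𝔼 n (f ∘ (false ∷_))

  ℙ : (n : ℕ) → (Subset n → Bool) → ℚ
  ℙ n χ = 𝔼 n (𝟙 ∘ χ)

  𝔼-cong : ∀ n {f g : Subset n → ℚ} → (∀ B → f B ≡ g B) → 𝔼 n f ≡ 𝔼 n g
  𝔼-cong zero    f≗g = f≗g []
  𝔼-cong (suc n) f≗g = cong₂ (λ a b → p * a + q * b) (𝔼-cong n (f≗g ∘ (true ∷_))) (𝔼-cong n (f≗g ∘ (false ∷_)))

  p*x+q*x≡x : ∀ x → p * x + q * x ≡ x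
  p*x+q*x≡x = identity p
    where
    identity : ∀ p x → p * x + (1ℚ - p) * x ≡ x
    identity = solve-∀ ℚ-ring

  𝔼-const : ∀ n c → 𝔼 n (λ _ → c) ≡ c
  𝔼-const zero    c = refl
  𝔼-const (suc n) c rewrite 𝔼-const n c = p*x+q*x≡x c

  𝔼-+ : ∀ n (f g : Subset n → ℚ) → 𝔼 n (λ B → f B + g B) ≡ 𝔼 n f + 𝔼 n g
  𝔼-+ zero    f g = refl
  𝔼-+ (suc n) f g rewrite 𝔼-+ n (f ∘ (true ∷_)) (g ∘ (true ∷_)) | 𝔼-+ n (f ∘ (false ∷_)) (g ∘ (false ∷_)) =
    interchange p q _ _ _ _
    where
    interchange : ∀ p q a b c d → p * (a + b) + q * (c + d) ≡ (p * a + q * c) + (p * b + q * d)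
    interchange = solve-∀ ℚ-ring

  𝔼-*ˡ : ∀ n c (f : Subset n → ℚ) → 𝔼 n (λ B → c * f B) ≡ c * 𝔼 n f
  𝔼-*ˡ zero    c f = refl
  𝔼-*ˡ (suc n) c f rewrite 𝔼-*ˡ n c (f ∘ (true ∷_)) | 𝔼-*ˡ n c (f ∘ (false ∷_)) = factor p q c _ _
    where
    factor : ∀ p q c a b → p * (c * a) + q * (c * b) ≡ c * (p * a + q * b)
    factor = solve-∀ ℚ-ring

  𝔼-*ʳ : ∀ n c (f : Subset n → ℚ) → 𝔼 n (λ B → f B * c) ≡ 𝔼 n f * c
  𝔼-*ʳ n c f = begin
    𝔼 n (λ B → f B * c)  ≡⟨ 𝔼-cong n (λ B → ℚ.*-comm (f B) c) ⟩
    𝔼 n (λ B → c * f B)  ≡⟨ 𝔼-*ˡ n c f ⟩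
    c * 𝔼 n f            ≡⟨ ℚ.*-comm c _ ⟩
    𝔼 n f * c            ∎
    where open ≡-Reasoning

  𝔼-complement : ∀ n (f : Subset n → ℚ) → 𝔼 n (λ B → 1ℚ - f B) ≡ 1ℚ - 𝔼 n f
  𝔼-complement n f = begin
    𝔼 n (λ B → 1ℚ - f B)                        ≡⟨ 𝔼-cong n (λ B → as-sum (f B)) ⟩
    𝔼 n (λ B → 1ℚ + (- 1ℚ) * f B)               ≡⟨ 𝔼-+ n (λ _ → 1ℚ) _ ⟩
    𝔼 n (λ _ → 1ℚ) + 𝔼 n (λ B → (- 1ℚ) * f B)  ≡⟨ cong₂ _+_ (𝔼-const n 1ℚ) (𝔼-*ˡ n (- 1ℚ) f) ⟩
    1ℚ + (- 1ℚ) * 𝔼 n f                         ≡⟨ as-sum (𝔼 n f) ⟨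
    1ℚ - 𝔼 n f                                  ∎
    where
    open ≡-Reasoning
    as-sum : ∀ x → 1ℚ - x ≡ 1ℚ + (- 1ℚ) * x
    as-sum = solve-∀ ℚ-ring

  weight : (n : ℕ) → Subset n → ℚ
  weight n B = (p ^ℚ ∣ B ∣) * (q ^ℚ (n ∸ ∣ B ∣))

  weighted-sum≡𝔼 : ∀ n (f : Subset n → ℚ) → sumℚ (List.map (λ B → weight n B * f B) (allSubsets n)) ≡ 𝔼 n f
  weighted-sum≡𝔼 zero    f = unit (f [])
    where
    unit : ∀ x → (1ℚ * 1ℚ) * x + 0ℚ ≡ x
    unit = solve-∀ ℚ-ring
  weighted-sum≡𝔼 (suc n) f = begin
    sumℚ (List.map g (List.map (true ∷_) Bs List.++ List.map (false ∷_) Bs))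
      ≡⟨ cong sumℚ (List.map-++ g (List.map (true ∷_) Bs) _) ⟩
    sumℚ (List.map g (List.map (true ∷_) Bs) List.++ List.map g (List.map (false ∷_) Bs))
      ≡⟨ sumℚ-++ (List.map g (List.map (true ∷_) Bs)) _ ⟩
    sumℚ (List.map g (List.map (true ∷_) Bs)) + sumℚ (List.map g (List.map (false ∷_) Bs))
      ≡⟨ cong₂ _+_ (branch p true (λ B → weight-true B (f (true ∷ B))))
                   (branch q false (λ B → weight-false B (f (false ∷ B)))) ⟩
    p * 𝔼 n (f ∘ (true ∷_)) + q * 𝔼 n (f ∘ (false ∷_))
      ∎
    where
    open ≡-Reasoning
    Bs : List (Subset n)
    Bs = allSubsets n
    g : Subset (suc n) → ℚ
    g B = weight (suc n) B * f B

    weight-true : ∀ B x → weight (suc n) (true ∷ B) * x ≡ p * (weight n B * x)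
    weight-true B x = reassoc p (p ^ℚ ∣ B ∣) (q ^ℚ (n ∸ ∣ B ∣)) x
      where
      reassoc : ∀ a b c d → (a * b) * c * d ≡ a * (b * c * d)
      reassoc = solve-∀ ℚ-ring

    weight-false : ∀ B x → weight (suc n) (false ∷ B) * x ≡ q * (weight n B * x)
    weight-false B x rewrite ℕ.+-∸-assoc 1 (∣p∣≤n B) = swap q (p ^ℚ ∣ B ∣) (q ^ℚ (n ∸ ∣ B ∣)) x
      where
      swap : ∀ a b c d → b * (a * c) * d ≡ a * (b * c * d)
      swap = solve-∀ ℚ-ring

    branch : ∀ c b → (∀ B → g (b ∷ B) ≡ c * (weight n B * f (b ∷ B))) →
             sumℚ (List.map g (List.map (b ∷_) Bs)) ≡ c * 𝔼 n (f ∘ (b ∷_))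
    branch c b g≡c*_ = begin
      sumℚ (List.map g (List.map (b ∷_) Bs))
        ≡⟨ cong sumℚ (trans (sym (List.map-∘ Bs)) (trans (List.map-cong g≡c*_ Bs) (List.map-∘ Bs))) ⟩
      sumℚ (List.map (c *_) (List.map (λ B → weight n B * f (b ∷ B)) Bs))
        ≡⟨ sumℚ-*ˡ c (List.map (λ B → weight n B * f (b ∷ B)) Bs) ⟩
      c * sumℚ (List.map (λ B → weight n B * f (b ∷ B)) Bs)
        ≡⟨ cong (c *_) (weighted-sum≡𝔼 n (f ∘ (b ∷_))) ⟩
      c * 𝔼 n (f ∘ (b ∷_))
        ∎

  ProbOf≡ℙ : ∀ n χ → ProbOf n χ p ≡ ℙ n χ
  ProbOf≡ℙ n χ = trans (cong sumℚ (List.map-cong weighted-𝟙 (allSubsets n))) (weighted-sum≡𝔼 n (𝟙 ∘ χ))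
    where
    weighted-𝟙 : ∀ B → (if χ B then weight n B else 0ℚ) ≡ weight n B * 𝟙 (χ B)
    weighted-𝟙 B with χ B
    ... | true  = sym (ℚ.*-identityʳ (weight n B))
    ... | false = sym (ℚ.*-zeroʳ (weight n B))

  𝔼-++ : ∀ a b (F : Subset (a ℕ.+ b) → ℚ) → 𝔼 (a ℕ.+ b) F ≡ 𝔼 a (λ xs → 𝔼 b (λ ys → F (xs ++ ys)))
  𝔼-++ zero    b F = refl
  𝔼-++ (suc a) b F = cong₂ (λ x y → p * x + q * y) (𝔼-++ a b (F ∘ (true ∷_))) (𝔼-++ a b (F ∘ (false ∷_)))

  𝔼-insertAt : ∀ k (i : Fin (suc k)) (F : Subset (suc k) → ℚ) →
               𝔼 (suc k) F ≡ p * 𝔼 k (λ xs → F (insertAt xs i true)) + q * 𝔼 k (λ xs → F (insertAt xs i false))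
  𝔼-insertAt k       Fin.zero    F = refl
  𝔼-insertAt (suc k) (Fin.suc i) F rewrite 𝔼-insertAt k i (F ∘ (true ∷_)) | 𝔼-insertAt k i (F ∘ (false ∷_)) =
    interchange p q _ _ _ _
    where
    interchange : ∀ p q a b c d →
                  p * (p * a + q * b) + q * (p * c + q * d) ≡ p * (p * a + q * c) + q * (p * b + q * d)
    interchange = solve-∀ ℚ-ring

  -- The first coordinate either lies outside the image of φ and integrates out, or it is
  -- φ j₀ and becomes coordinate j₀ of the marginal.
  𝔼-restrict : ∀ n k (φ : Fin k → Fin n) → Injective _≡_ _≡_ φ → (F : Subset k → ℚ) → 𝔼 n (F ∘ restrict φ) ≡ 𝔼 k F
  𝔼-restrict zero    zero    φ φ-inj F = refl
  𝔼-restrict zero    (suc k) φ φ-inj F with φ Fin.zero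
  ... | ()
  𝔼-restrict (suc n) k φ φ-inj F with any? (λ j → φ j ≟ Fin.zero)
  ... | no 0∉φ = begin
      p * 𝔼 n (F ∘ restrict φ ∘ (true ∷_)) + q * 𝔼 n (F ∘ restrict φ ∘ (false ∷_))
        ≡⟨ cong₂ (λ a b → p * a + q * b) (shift true) (shift false) ⟩
      p * 𝔼 k F + q * 𝔼 k F
        ≡⟨ p*x+q*x≡x (𝔼 k F) ⟩
      𝔼 k F ∎
    where
    open ≡-Reasoning
    0≢φ : ∀ j → Fin.zero ≢ φ j
    0≢φ j e = 0∉φ (j , sym e)
    φ′ : Fin k → Fin n
    φ′ j = punchOut (0≢φ j)
    φ′-inj : Injective _≡_ _≡_ φ′
    φ′-inj e = φ-inj (Fin.punchOut-injective (0≢φ _) (0≢φ _) e)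
    shift : ∀ b → 𝔼 n (F ∘ restrict φ ∘ (b ∷_)) ≡ 𝔼 k F
    shift b = trans (𝔼-cong n (λ B → cong F (Vec.tabulate-cong (λ j →
                       cong (lookup (b ∷ B)) (sym (Fin.punchIn-punchOut (0≢φ j)))))))
                    (𝔼-restrict n k φ′ φ′-inj F)
  𝔼-restrict (suc n) (suc k) φ φ-inj F | yes (j₀ , φj₀≡0) = begin
      p * 𝔼 n (F ∘ restrict φ ∘ (true ∷_)) + q * 𝔼 n (F ∘ restrict φ ∘ (false ∷_))
        ≡⟨ cong₂ (λ a b → p * a + q * b) (insert true) (insert false) ⟩
      p * 𝔼 k (λ xs → F (insertAt xs j₀ true)) + q * 𝔼 k (λ xs → F (insertAt xs j₀ false))
        ≡⟨ 𝔼-insertAt k j₀ F ⟨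
      𝔼 (suc k) F ∎
    where
    open ≡-Reasoning
    0≢φ : ∀ j → Fin.zero ≢ φ (punchIn j₀ j)
    0≢φ j e = Fin.punchInᵢ≢i j₀ j (φ-inj (trans (sym e) (sym φj₀≡0)))
    φ′ : Fin k → Fin n
    φ′ j = punchOut (0≢φ j)
    φ′-inj : Injective _≡_ _≡_ φ′
    φ′-inj {i} {j} e = Fin.punchIn-injective j₀ i j (φ-inj (Fin.punchOut-injective (0≢φ i) (0≢φ j) e))
    restrict-∷ : ∀ b B → restrict φ (b ∷ B) ≡ insertAt (restrict φ′ B) j₀ b
    restrict-∷ b B = trans (tabulate-insertAt (lookup (b ∷ B) ∘ φ) j₀)
      (cong₂ (λ xs x → insertAt xs j₀ x)
        (Vec.tabulate-cong (λ j → cong (lookup (b ∷ B)) (sym (Fin.punchIn-punchOut (0≢φ j)))))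
        (cong (lookup (b ∷ B)) φj₀≡0))
    insert : ∀ b → 𝔼 n (F ∘ restrict φ ∘ (b ∷_)) ≡ 𝔼 k (λ xs → F (insertAt xs j₀ b))
    insert b = trans (𝔼-cong n (λ B → cong F (restrict-∷ b B)))
                     (𝔼-restrict n k φ′ φ′-inj (λ xs → F (insertAt xs j₀ b)))

  𝔼-product : ∀ a b (F : Subset a → ℚ) (G : Subset b → ℚ) → 𝔼 a (λ xs → 𝔼 b (λ ys → F xs * G ys)) ≡ 𝔼 a F * 𝔼 b G
  𝔼-product a b F G = trans (𝔼-cong a (λ xs → 𝔼-*ˡ b (F xs) G)) (𝔼-*ʳ a (𝔼 b G) F)

  𝔼-++-* : ∀ a b (H : Subset (a ℕ.+ b) → ℚ) (F : Subset a → ℚ) (G : Subset b → ℚ) →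
           (∀ xs ys → H (xs ++ ys) ≡ F xs * G ys) → 𝔼 (a ℕ.+ b) H ≡ 𝔼 a F * 𝔼 b G
  𝔼-++-* a b H F G split = begin
    𝔼 (a ℕ.+ b) H                           ≡⟨ 𝔼-++ a b H ⟩
    𝔼 a (λ xs → 𝔼 b (λ ys → H (xs ++ ys)))  ≡⟨ 𝔼-cong a (λ xs → 𝔼-cong b (split xs)) ⟩
    𝔼 a (λ xs → 𝔼 b (λ ys → F xs * G ys))   ≡⟨ 𝔼-product a b F G ⟩
    𝔼 a F * 𝔼 b G                           ∎
    where open ≡-Reasoning

  𝔼-independent : ∀ {n s t} (f : Fin s → Fin n) (g : Fin t → Fin n) →
    Injective _≡_ _≡_ f → Injective _≡_ _≡_ g → (∀ i j → f i ≢ g j) →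
    (F : Subset s → ℚ) (G : Subset t → ℚ) → 𝔼 n (λ B → F (restrict f B) * G (restrict g B)) ≡ 𝔼 s F * 𝔼 t G
  𝔼-independent {n} {s} {t} f g f-inj g-inj f≢g F G = begin
    𝔼 n (λ B → F (restrict f B) * G (restrict g B))
      ≡⟨ 𝔼-cong n (λ B → trans (cong H (restrict-++ f g B)) (H-++ _ _)) ⟨
    𝔼 n (H ∘ restrict ([ f , g ]′ ∘ splitAt s))
      ≡⟨ 𝔼-restrict n (s ℕ.+ t) _ ([,]∘splitAt-injective f-inj g-inj f≢g) H ⟩
    𝔼 (s ℕ.+ t) H
      ≡⟨ 𝔼-++-* s t H F G H-++ ⟩
    𝔼 s F * 𝔼 t G
      ∎
    where
    open ≡-Reasoning
    H : Subset (s ℕ.+ t) → ℚ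
    H C = F (take s C) * G (drop s C)
    H-++ : ∀ xs ys → H (xs ++ ys) ≡ F xs * G ys
    H-++ xs ys = cong₂ (λ as bs → F as * G bs) (proj₁ (take-drop-++ xs ys)) (proj₂ (take-drop-++ xs ys))

  module _ (0≤p : 0ℚ ≤ p) (p≤1 : p ≤ 1ℚ) where

    0≤q : 0ℚ ≤ q
    0≤q = p≤q⇒0≤q-p p≤1

    𝔼-mono : ∀ n {f g : Subset n → ℚ} → (∀ B → f B ≤ g B) → 𝔼 n f ≤ 𝔼 n g
    𝔼-mono zero    f≤g = f≤g []
    𝔼-mono (suc n) f≤g = ℚ.+-mono-≤
      (ℚ.*-monoˡ-≤-nonNeg p {{nonNegative 0≤p}} (𝔼-mono n (f≤g ∘ (true ∷_))))
      (ℚ.*-monoˡ-≤-nonNeg q {{nonNegative 0≤q}} (𝔼-mono n (f≤g ∘ (false ∷_))))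

    𝔼-++-≤* : ∀ a b (H : Subset (a ℕ.+ b) → ℚ) (F : Subset a → ℚ) (G : Subset b → ℚ) →
              (∀ xs ys → H (xs ++ ys) ≤ F xs * G ys) → 𝔼 (a ℕ.+ b) H ≤ 𝔼 a F * 𝔼 b G
    𝔼-++-≤* a b H F G split = begin
      𝔼 (a ℕ.+ b) H                           ≡⟨ 𝔼-++ a b H ⟩
      𝔼 a (λ xs → 𝔼 b (λ ys → H (xs ++ ys)))  ≤⟨ 𝔼-mono a (λ xs → 𝔼-mono b (split xs)) ⟩
      𝔼 a (λ xs → 𝔼 b (λ ys → F xs * G ys))   ≡⟨ 𝔼-product a b F G ⟩
      𝔼 a F * 𝔼 b G                           ∎
      where open ℚ.≤-Reasoning

    ℙ-++ : ∀ a b (χ : Subset (a ℕ.+ b) → Bool) (φ : Subset a → Bool) (ψ : Subset b → Bool) →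
           (∀ xs ys → χ (xs ++ ys) ≡ true → φ xs ≡ true × ψ ys ≡ true) → ℙ (a ℕ.+ b) χ ≤ ℙ a φ * ℙ b ψ
    ℙ-++ a b χ φ ψ split = 𝔼-++-≤* a b (𝟙 ∘ χ) (𝟙 ∘ φ) (𝟙 ∘ ψ) (λ xs ys →
      ℚ.≤-trans (𝟙-mono (λ χ≡true → let φ≡true , ψ≡true = split xs ys χ≡true in cong₂ _∧_ φ≡true ψ≡true))
                (ℚ.≤-reflexive (𝟙-∧ (φ xs) (ψ ys))))

    ℙ-nonNeg : ∀ n χ → 0ℚ ≤ ℙ n χ
    ℙ-nonNeg n χ = ℚ.≤-trans (ℚ.≤-reflexive (sym (𝔼-const n 0ℚ))) (𝔼-mono n (𝟙-nonNeg ∘ χ))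

    ℙ≤1 : ∀ n χ → ℙ n χ ≤ 1ℚ
    ℙ≤1 n χ = ℚ.≤-trans (𝔼-mono n (𝟙≤1 ∘ χ)) (ℚ.≤-reflexive (𝔼-const n 1ℚ))

    ℙ-disjoint : ∀ n (χ ψ : Subset n → Bool) → (∀ B → χ B ≡ true → ψ B ≡ true → ⊥) → ℙ n χ ≤ 1ℚ - ℙ n ψ
    ℙ-disjoint n χ ψ disjoint = ℚ.≤-trans (𝔼-mono n pointwise) (ℚ.≤-reflexive (𝔼-complement n (𝟙 ∘ ψ)))
      where
      pointwise : ∀ B → 𝟙 (χ B) ≤ 1ℚ - 𝟙 (ψ B)
      pointwise B with ψ B in ψB | χ B in χB
      ... | false | c     = 𝟙≤1 c
      ... | true  | false = ℚ.≤-refl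
      ... | true  | true  = ⊥-elim (disjoint B χB ψB)

    ℙ-cover : ∀ n (χ ψ : Subset n → Bool) → (∀ B → ψ B ≡ false → χ B ≡ true) → 1ℚ - ℙ n ψ ≤ ℙ n χ
    ℙ-cover n χ ψ cover = ℚ.≤-trans (ℚ.≤-reflexive (sym (𝔼-complement n (𝟙 ∘ ψ)))) (𝔼-mono n pointwise)
      where
      pointwise : ∀ B → 1ℚ - 𝟙 (ψ B) ≤ 𝟙 (χ B)
      pointwise B with ψ B in ψB
      ... | true  = 𝟙-nonNeg (χ B)
      ... | false rewrite cover B ψB = ℚ.≤-refl

-- Spaced bit strings

spaced : ∀ {k} → Vec Bool k → Bool
spaced []                  = true
spaced (false ∷ xs)        = spaced xs
spaced (true ∷ [])         = true
spaced (true ∷ false ∷ xs) = spaced xs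
spaced (true ∷ true ∷ xs)  = false

spacedʳ : ∀ {k} → Vec Bool k → Bool
spacedʳ []                  = true
spacedʳ (false ∷ xs)        = spacedʳ xs
spacedʳ (true ∷ [])         = false
spacedʳ (true ∷ false ∷ xs) = spacedʳ xs
spacedʳ (true ∷ true ∷ xs)  = false

spacedˡʳ : ∀ {k} → Vec Bool k → Bool
spacedˡʳ []           = true
spacedˡʳ (false ∷ xs) = spacedʳ xs
spacedˡʳ (true ∷ xs)  = false

spacedʳ⇒spaced : ∀ {k} (xs : Vec Bool k) → spacedʳ xs ≡ true → spaced xs ≡ true
spacedʳ⇒spaced []                  _ = refl
spacedʳ⇒spaced (false ∷ xs)        h = spacedʳ⇒spaced xs h
spacedʳ⇒spaced (true ∷ false ∷ xs) h = spacedʳ⇒spaced xs h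

spaced-++ : ∀ {a b} (xs : Vec Bool a) (ys : Vec Bool b) →
            spaced (xs ++ ys) ≡ true → spaced xs ≡ true × spaced ys ≡ true
spaced-++ []                  ys           h = refl , h
spaced-++ (false ∷ xs)        ys           h = spaced-++ xs ys h
spaced-++ (true ∷ [])         []           h = refl , refl
spaced-++ (true ∷ [])         (false ∷ ys) h = refl , h
spaced-++ (true ∷ false ∷ xs) ys           h = spaced-++ xs ys h

spacedʳ-++ : ∀ {a b} (xs : Vec Bool a) (ys : Vec Bool b) →
             spacedʳ (xs ++ ys) ≡ true → spaced xs ≡ true × spacedʳ ys ≡ true
spacedʳ-++ []                  ys           h = refl , h
spacedʳ-++ (false ∷ xs)        ys           h = spacedʳ-++ xs ys h
spacedʳ-++ (true ∷ [])         (false ∷ ys) h = refl , h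
spacedʳ-++ (true ∷ false ∷ xs) ys           h = spacedʳ-++ xs ys h

spacedʳ-++-false : ∀ {k} (xs : Vec Bool k) → spacedʳ (xs ++ false ∷ []) ≡ spaced xs
spacedʳ-++-false []                  = refl
spacedʳ-++-false (false ∷ xs)        = spacedʳ-++-false xs
spacedʳ-++-false (true ∷ [])         = refl
spacedʳ-++-false (true ∷ false ∷ xs) = spacedʳ-++-false xs
spacedʳ-++-false (true ∷ true ∷ xs)  = refl

Isolated : ∀ {k} → Vec Bool k → Fin k → Set
Isolated {k} xs j = ∃ λ (j⁻ : Fin k) → ∃ λ (j⁺ : Fin k) →
  suc (toℕ j⁻) ≡ toℕ j × toℕ j⁺ ≡ suc (toℕ j) × lookup xs j⁻ ≡ false × lookup xs j⁺ ≡ false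

Isolated-∷ : ∀ {k} x (xs : Vec Bool k) {j} → Isolated xs j → Isolated (x ∷ xs) (Fin.suc j)
Isolated-∷ x xs (j⁻ , j⁺ , below , above , xs[j⁻] , xs[j⁺]) =
  Fin.suc j⁻ , Fin.suc j⁺ , cong suc below , cong suc above , xs[j⁻] , xs[j⁺]

spacedˡʳ⇒isolated : ∀ {k} (xs : Vec Bool k) → spacedˡʳ xs ≡ true →
                    ∀ j → lookup xs j ≡ true → Isolated xs j
spacedˡʳ⇒isolated (false ∷ xs) h = after-false xs h
  where
  after-false : ∀ {k} (xs : Vec Bool k) → spacedʳ xs ≡ true →
                ∀ j → lookup (false ∷ xs) j ≡ true → Isolated (false ∷ xs) j
  after-false (false ∷ xs)        h (Fin.suc j)           e = Isolated-∷ false _ (after-false xs h j e)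
  after-false (true ∷ false ∷ xs) h (Fin.suc Fin.zero)    e =
    Fin.zero , Fin.suc (Fin.suc Fin.zero) , refl , refl , refl , refl
  after-false (true ∷ false ∷ xs) h (Fin.suc (Fin.suc j)) e =
    Isolated-∷ false _ (Isolated-∷ true _ (after-false xs h j e))

FirstTrue LastTrue AdjacentTrue : ∀ {k} → Vec Bool k → Set
FirstTrue    xs = ∃ λ i → toℕ i ≡ 0 × lookup xs i ≡ true
LastTrue {k} xs = ∃ λ i → suc (toℕ i) ≡ k × lookup xs i ≡ true
AdjacentTrue xs = ∃ λ i → ∃ λ j → toℕ j ≡ suc (toℕ i) × lookup xs i ≡ true × lookup xs j ≡ true

Defectʳ : ∀ {k} → Vec Bool k → Set
Defectʳ xs = LastTrue xs ⊎ AdjacentTrue xs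

Defectʳ-∷ : ∀ {k} x {xs : Vec Bool k} → Defectʳ xs → Defectʳ (x ∷ xs)
Defectʳ-∷ x (inj₁ (i , last , xs[i]))             = inj₁ (Fin.suc i , cong suc last , xs[i])
Defectʳ-∷ x (inj₂ (i , j , next , xs[i] , xs[j])) =
  inj₂ (Fin.suc i , Fin.suc j , cong suc next , xs[i] , xs[j])

¬spacedʳ⇒Defectʳ : ∀ {k} (xs : Vec Bool k) → spacedʳ xs ≡ false → Defectʳ xs
¬spacedʳ⇒Defectʳ (true ∷ [])         _ = inj₁ (Fin.zero , refl , refl)
¬spacedʳ⇒Defectʳ (true ∷ true ∷ xs)  _ = inj₂ (Fin.zero , Fin.suc Fin.zero , refl , refl , refl)
¬spacedʳ⇒Defectʳ (false ∷ xs)        h = Defectʳ-∷ false (¬spacedʳ⇒Defectʳ xs h)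
¬spacedʳ⇒Defectʳ (true ∷ false ∷ xs) h = Defectʳ-∷ true (Defectʳ-∷ false (¬spacedʳ⇒Defectʳ xs h))

¬spacedˡʳ⇒Defect : ∀ {k} (xs : Vec Bool k) → spacedˡʳ xs ≡ false → FirstTrue xs ⊎ Defectʳ xs
¬spacedˡʳ⇒Defect (true ∷ xs)  _ = inj₁ (Fin.zero , refl , refl)
¬spacedˡʳ⇒Defect (false ∷ xs) h = inj₂ (Defectʳ-∷ false (¬spacedʳ⇒Defectʳ xs h))

module SpacedProbabilities (p : ℚ) (0≤p : 0ℚ ≤ p) (p<1 : p < 1ℚ) where
  open Bernoulli p

  private
    p≤1 : p ≤ 1ℚ
    p≤1 = ℚ.<⇒≤ p<1

    0<q : 0ℚ < q
    0<q = p<q⇒0<q-p p<1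

    *-monoˡ : ∀ c {a b} → 0ℚ ≤ c → a ≤ b → c * a ≤ c * b
    *-monoˡ c 0≤c = ℚ.*-monoˡ-≤-nonNeg c {{nonNegative 0≤c}}

  ℙ-spacedʳ≤ℙ-spaced : ∀ k → ℙ k spacedʳ ≤ ℙ k spaced
  ℙ-spacedʳ≤ℙ-spaced k = 𝔼-mono 0≤p p≤1 k (λ xs → 𝟙-mono (spacedʳ⇒spaced xs))

  ℙ-spacedʳ-pos : ∀ k → 0ℚ < ℙ k spacedʳ
  ℙ-spacedʳ-pos zero    = ℚ.positive⁻¹ 1ℚ
  ℙ-spacedʳ-pos (suc k) = ℚ.+-mono-≤-<
    (0≤*0≤⇒0≤* 0≤p (ℙ-nonNeg 0≤p p≤1 k (spacedʳ ∘ (true ∷_))))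
    (0<*0<⇒0<* 0<q (ℙ-spacedʳ-pos k))

  ℙ-spaced-pos : ∀ k → 0ℚ < ℙ k spaced
  ℙ-spaced-pos k = ℚ.<-≤-trans (ℙ-spacedʳ-pos k) (ℙ-spacedʳ≤ℙ-spaced k)

  ℙ-spaced-++ : ∀ a b → ℙ (a ℕ.+ b) spaced ≤ ℙ a spaced * ℙ b spaced
  ℙ-spaced-++ a b = ℙ-++ 0≤p p≤1 a b spaced spaced spaced spaced-++

  ℙ-spacedʳ-++ : ∀ a b → ℙ (a ℕ.+ b) spacedʳ ≤ ℙ a spaced * ℙ b spacedʳ
  ℙ-spacedʳ-++ a b = ℙ-++ 0≤p p≤1 a b spacedʳ spaced spacedʳ spacedʳ-++

  ℙ-spaced-antitone : ∀ {a b} → a ℕ.≤ b → ℙ b spaced ≤ ℙ a spaced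
  ℙ-spaced-antitone {a} a≤b with ℕ.m≤n⇒∃[o]m+o≡n a≤b
  ... | d , refl = begin
    ℙ (a ℕ.+ d) spaced        ≤⟨ ℙ-spaced-++ a d ⟩
    ℙ a spaced * ℙ d spaced   ≤⟨ *-monoˡ (ℙ a spaced) (ℙ-nonNeg 0≤p p≤1 a spaced) (ℙ≤1 0≤p p≤1 d spaced) ⟩
    ℙ a spaced * 1ℚ           ≡⟨ ℚ.*-identityʳ _ ⟩
    ℙ a spaced                ∎
    where open ℚ.≤-Reasoning

  q*ℙ-spaced≤ℙ-spacedʳ : ∀ a → q * ℙ a spaced ≤ ℙ a spacedʳ
  q*ℙ-spaced≤ℙ-spacedʳ zero    = ℚ.≤-trans (ℚ.≤-reflexive (ℚ.*-identityʳ q)) q≤1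
    where
    q≤1 : q ≤ 1ℚ
    q≤1 = ℚ.≤-trans (ℚ.+-monoʳ-≤ 1ℚ (ℚ.neg-antimono-≤ 0≤p)) (ℚ.≤-reflexive (ℚ.+-identityʳ 1ℚ))
  q*ℙ-spaced≤ℙ-spacedʳ (suc a) = begin
    q * ℙ (suc a) spaced
      ≤⟨ *-monoˡ q (ℚ.<⇒≤ 0<q) (ℙ-spaced-antitone (ℕ.n≤1+n a)) ⟩
    q * ℙ a spaced
      ≡⟨ 𝔼-*ˡ a q (𝟙 ∘ spaced) ⟨
    𝔼 a (λ xs → q * 𝟙 (spaced xs))
      ≤⟨ 𝔼-mono 0≤p p≤1 a (λ xs → ℚ.≤-trans (ℚ.≤-reflexive (sym (ℚ.+-identityˡ _)))
           (ℚ.+-monoˡ-≤ _ (0≤*0≤⇒0≤* 0≤p (𝟙-nonNeg (spacedʳ (xs ++ true ∷ [])))))) ⟩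
    𝔼 a (λ xs → p * 𝟙 (spacedʳ (xs ++ true ∷ [])) + q * 𝟙 (spaced xs))
      ≡⟨ 𝔼-cong a (λ xs → cong (λ b → p * 𝟙 (spacedʳ (xs ++ true ∷ [])) + q * 𝟙 b)
                              (spacedʳ-++-false xs)) ⟨
    𝔼 a (λ xs → 𝔼 1 (λ ys → 𝟙 (spacedʳ (xs ++ ys))))
      ≡⟨ 𝔼-++ a 1 (𝟙 ∘ spacedʳ) ⟨
    ℙ (a ℕ.+ 1) spacedʳ
      ≡⟨ cong (λ m → ℙ m spacedʳ) (ℕ.+-comm a 1) ⟩
    ℙ (suc a) spacedʳ ∎
    where open ℚ.≤-Reasoning

  ℙ-spacedˡʳ-suc : ∀ k → ℙ (suc k) spacedˡʳ ≡ q * ℙ k spacedʳ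
  ℙ-spacedˡʳ-suc k rewrite 𝔼-const k 0ℚ = drop-zero p q (ℙ k spacedʳ)
    where
    drop-zero : ∀ p q x → p * 0ℚ + q * x ≡ q * x
    drop-zero = solve-∀ ℚ-ring

  ℙ-spaced-2 : ℙ 2 spaced ≡ 1ℚ - p * p
  ℙ-spaced-2 = expand p
    where
    expand : ∀ p → p * (p * 0ℚ + (1ℚ - p) * 1ℚ) + (1ℚ - p) * (p * 1ℚ + (1ℚ - p) * 1ℚ) ≡ 1ℚ - p * p
    expand = solve-∀ ℚ-ring

  ℙ-spaced-pairs : ∀ K → ℙ (K ℕ.+ K) spaced ≤ (1ℚ - p * p) ^ℚ K
  ℙ-spaced-pairs zero    = ℚ.≤-refl
  ℙ-spaced-pairs (suc K) = begin
    ℙ (suc K ℕ.+ suc K) spaced            ≡⟨ cong (λ m → ℙ (suc m) spaced) (ℕ.+-suc K K) ⟩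
    ℙ (2 ℕ.+ (K ℕ.+ K)) spaced            ≤⟨ ℙ-spaced-++ 2 (K ℕ.+ K) ⟩
    ℙ 2 spaced * ℙ (K ℕ.+ K) spaced       ≤⟨ *-monoˡ (ℙ 2 spaced) (ℙ-nonNeg 0≤p p≤1 2 spaced) (ℙ-spaced-pairs K) ⟩
    ℙ 2 spaced * (1ℚ - p * p) ^ℚ K        ≡⟨ cong (_* ((1ℚ - p * p) ^ℚ K)) ℙ-spaced-2 ⟩
    (1ℚ - p * p) ^ℚ suc K                 ∎
    where open ℚ.≤-Reasoning

  ℙ-spacedˡʳ-split : ∀ s M t → ℙ M spaced < q * q →
                     ℙ (suc (s ℕ.+ (M ℕ.+ t))) spacedˡʳ < ℙ (suc s) spacedˡʳ * ℙ (suc t) spacedˡʳ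
  ℙ-spacedˡʳ-split s M t short = begin-strict
    ℙ (suc (s ℕ.+ (M ℕ.+ t))) spacedˡʳ
      ≡⟨ ℙ-spacedˡʳ-suc (s ℕ.+ (M ℕ.+ t)) ⟩
    q * ℙ (s ℕ.+ (M ℕ.+ t)) spacedʳ
      ≤⟨ *-monoˡ q (ℚ.<⇒≤ 0<q) (ℚ.≤-trans (ℙ-spacedʳ-++ s (M ℕ.+ t))
           (*-monoˡ (ℙ s spaced) (ℚ.<⇒≤ (ℙ-spaced-pos s)) (ℙ-spacedʳ-++ M t))) ⟩
    q * (ℙ s spaced * (ℙ M spaced * ℙ t spacedʳ))
      <⟨ ℚ.*-monoʳ-<-pos q {{positive 0<q}} (ℚ.*-monoʳ-<-pos (ℙ s spaced) {{positive (ℙ-spaced-pos s)}}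
           (ℚ.*-monoˡ-<-pos (ℙ t spacedʳ) {{positive (ℙ-spacedʳ-pos t)}} short)) ⟩
    q * (ℙ s spaced * ((q * q) * ℙ t spacedʳ))
      ≡⟨ regroup q (ℙ s spaced) (ℙ t spacedʳ) ⟩
    (q * (q * ℙ s spaced)) * (q * ℙ t spacedʳ)
      ≤⟨ ℚ.*-monoʳ-≤-nonNeg (q * ℙ t spacedʳ) {{nonNegative (ℚ.<⇒≤ q*ℙ-pos)}}
           (*-monoˡ q (ℚ.<⇒≤ 0<q) (q*ℙ-spaced≤ℙ-spacedʳ s)) ⟩
    (q * ℙ s spacedʳ) * (q * ℙ t spacedʳ)
      ≡⟨ cong₂ _*_ (ℙ-spacedˡʳ-suc s) (ℙ-spacedˡʳ-suc t) ⟨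
    ℙ (suc s) spacedˡʳ * ℙ (suc t) spacedˡʳ ∎
    where
    open ℚ.≤-Reasoning
    regroup : ∀ q a b → q * (a * ((q * q) * b)) ≡ (q * (q * a)) * (q * b)
    regroup = solve-∀ ℚ-ring
    q*ℙ-pos : 0ℚ < q * ℙ t spacedʳ
    q*ℙ-pos = 0<*0<⇒0<* 0<q (ℙ-spacedʳ-pos t)

  module _ (0<p : 0ℚ < p) where

    ℙ-spaced<q*q : ∀ k → ι 8 ≤ ι (14 ℕ.+ k) * p → ℙ (15 ℕ.+ k) spaced < q * q
    ℙ-spaced<q*q k 8≤[14+k]p = begin-strict
      ℙ (15 ℕ.+ k) spaced                 ≤⟨ ℙ-spaced-antitone (ℕ.≤-trans (ℕ.≤-reflexive (pairs e))
                                                                         (ℕ.+-monoʳ-≤ 14 2e≤1+k)) ⟩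
      ℙ ((7 ℕ.+ e) ℕ.+ (7 ℕ.+ e)) spaced  ≤⟨ ℙ-spaced-pairs (7 ℕ.+ e) ⟩
      (1ℚ - p * p) ^ℚ (2 ℕ.+ (5 ℕ.+ e))   <⟨ [1-x²]^[2+c]<[1-x]² (5 ℕ.+ e) 0<p p<1
                                               (8≤[14+2e]x⇒2+x<[5+e]x e (ℚ.<⇒≤ 0<p) 8≤[14+2e]p) ⟩
      q * q                               ∎
      where
      open ℚ.≤-Reasoning
      e : ℕ
      e = ⌈ k /2⌉
      k≤2e : k ℕ.≤ e ℕ.+ e
      k≤2e = proj₁ (⌈n/2⌉-bounds k)
      2e≤1+k : e ℕ.+ e ℕ.≤ suc k
      2e≤1+k = proj₂ (⌈n/2⌉-bounds k)
      pairs : ∀ e → (7 ℕ.+ e) ℕ.+ (7 ℕ.+ e) ≡ 14 ℕ.+ (e ℕ.+ e)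
      pairs = solve-∀ ℕ-ring
      8≤[14+2e]p : ι 8 ≤ ι (14 ℕ.+ (e ℕ.+ e)) * p
      8≤[14+2e]p = ℚ.≤-trans 8≤[14+k]p
        (ℚ.*-monoʳ-≤-nonNeg p {{nonNegative (ℚ.<⇒≤ 0<p)}} (ι-mono (ℕ.+-monoʳ-≤ 14 k≤2e)))

    ℙ-spacedˡʳ-gap : ∀ {s t} k → 1 ℕ.≤ s → 1 ℕ.≤ t → ι 8 ≤ ι (14 ℕ.+ k) * p →
                     ℙ (s ℕ.+ t ℕ.+ 14 ℕ.+ k) spacedˡʳ < ℙ s spacedˡʳ * ℙ t spacedˡʳ
    ℙ-spacedˡʳ-gap {suc s} {suc t} k _ _ 8≤[14+k]p =
      subst (λ m → ℙ m spacedˡʳ < ℙ (suc s) spacedˡʳ * ℙ (suc t) spacedˡʳ) (arrange s t k)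
        (ℙ-spacedˡʳ-split s (15 ℕ.+ k) t (ℙ-spaced<q*q k 8≤[14+k]p))
      where
      arrange : ∀ s t k → suc (s ℕ.+ ((15 ℕ.+ k) ℕ.+ t)) ≡ suc s ℕ.+ suc t ℕ.+ 14 ℕ.+ k
      arrange = solve-∀ ℕ-ring


-- Zero forcing

Adj-sym : ∀ {n} {G : Graph n} {x y} → Adj G x y → Adj G y x
Adj-sym {G = G} {x} {y} x~y = trans (Graph.sym G y x) x~y

two-white-neighbours⇒¬force : ∀ {n} {G : Graph n} {X : Subset n} {z x a b} →
  a ≢ b → Adj G z a → Adj G z b → a ∉ X → b ∉ X → ¬ (∀ y → Adj G z y → y ≢ x → y ∈ X)
two-white-neighbours⇒¬force {x = x} {a} a≢b z~a z~b a∉X b∉X others with a Fin.≟ x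
... | yes refl = b∉X (others _ z~b (a≢b ∘ sym))
... | no  a≢x  = a∉X (others a z~a a≢x)

Reach : ∀ {n} → Graph n → Subset n → (Fin n → Set) → Set
Reach G B X = ∃ λ B′ → Star (Force G) B B′ × (∀ v → X v → v ∈ B′)

Reach-base : ∀ {n} {G : Graph n} {B} (X : Fin n → Set) → (∀ v → X v → lookup B v ≡ true) → Reach G B X
Reach-base {B = B} X X⊆B = B , ε , λ v x → Vec.lookup⇒[]= v B (X⊆B v x)

Reach-weaken : ∀ {n} {G : Graph n} {B X Y} → (∀ v → Y v → X v) → Reach G B X → Reach G B Y
Reach-weaken Y⊆X (B′ , steps , X⊆B′) = B′ , steps , λ v y → X⊆B′ v (Y⊆X v y)

Reach-force : ∀ {n} {G : Graph n} {B X} (u v : Fin n) → Adj G u v → X u →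
              (∀ y → Adj G u y → y ≢ v → X y) → Reach G B X → Reach G B (λ y → X y ⊎ y ≡ v)
Reach-force u v u~v Xu others (B′ , steps , X⊆B′) with v Subset.∈? B′
... | yes v∈B′ = B′ , steps , λ { y (inj₁ Xy) → X⊆B′ y Xy ; y (inj₂ refl) → v∈B′ }
... | no  v∉B′ =
  B′ ∪ ⁅ v ⁆ ,
  steps ◅◅ (force u v (X⊆B′ u Xu) v∉B′ u~v (λ y u~y y≢v → X⊆B′ y (others y u~y y≢v)) ◅ ε) ,
  λ { y (inj₁ Xy)   → Subset.x∈p∪q⁺ (inj₁ (X⊆B′ y Xy))
    ; y (inj₂ refl) → Subset.x∈p∪q⁺ (inj₂ (Subset.x∈⁅x⁆ v)) }

-- Zero forcing on paths

Path-adj⁻ : ∀ {n} {u y : Fin n} → Adj (Path n) u y → toℕ y ≡ suc (toℕ u) ⊎ suc (toℕ y) ≡ toℕ u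
Path-adj⁻ {u = u} {y} u~y with suc (toℕ u) ≡ᵇ toℕ y in right
... | true  = inj₁ (sym (ℕ.≡ᵇ⇒≡ (suc (toℕ u)) (toℕ y) (subst T (sym right) _)))
... | false = inj₂ (ℕ.≡ᵇ⇒≡ (suc (toℕ y)) (toℕ u) (subst T (sym u~y) _))

Path-adj⁺ : ∀ {n} {u y : Fin n} → toℕ y ≡ suc (toℕ u) → Adj (Path n) u y
Path-adj⁺ {u = u} {y} y≡1+u with suc (toℕ u) ≡ᵇ toℕ y in right
... | true  = refl
... | false = ⊥-elim (subst T right (ℕ.≡⇒≡ᵇ (suc (toℕ u)) (toℕ y) (sym y≡1+u)))

module PathForcing {n} (B : Subset n) where

  Between : ℕ → ℕ → Fin n → Set
  Between a b v = a ℕ.≤ toℕ v × toℕ v ℕ.≤ b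

  AtLeast : ℕ → Fin n → Set
  AtLeast a v = a ℕ.≤ toℕ v

  private
    Reachᴾ : (Fin n → Set) → Set
    Reachᴾ = Reach (Path n) B

    predecessor-covered : ∀ {a b c} → (a ≡ 0 ⊎ a ℕ.< b) → suc c ≡ b → a ℕ.≤ c
    predecessor-covered (inj₁ refl) _    = z≤n
    predecessor-covered (inj₂ a<b)  refl = ℕ.≤-pred a<b

  extend-right : ∀ {a b} → a ℕ.≤ b → (a ≡ 0 ⊎ a ℕ.< b) → suc b ℕ.< n →
                 Reachᴾ (Between a b) → Reachᴾ (Between a (suc b))
  extend-right {a} {b} a≤b left-covered 1+b<n reach = Reach-weaken split
    (Reach-force u v (Path-adj⁺ (trans v≡1+b (cong suc (sym u≡b)))) (a≤u , ℕ.≤-reflexive u≡b) others reach)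
    where
    u v : Fin n
    u = fromℕ< (ℕ.<-trans (ℕ.n<1+n b) 1+b<n)
    v = fromℕ< 1+b<n
    u≡b : toℕ u ≡ b
    u≡b = Fin.toℕ-fromℕ< _
    v≡1+b : toℕ v ≡ suc b
    v≡1+b = Fin.toℕ-fromℕ< 1+b<n
    a≤u : a ℕ.≤ toℕ u
    a≤u = subst (a ℕ.≤_) (sym u≡b) a≤b
    others : ∀ y → Adj (Path n) u y → y ≢ v → Between a b y
    others y u~y y≢v with Path-adj⁻ u~y
    ... | inj₁ y≡1+u = ⊥-elim (y≢v (Fin.toℕ-injective (trans y≡1+u (trans (cong suc u≡b) (sym v≡1+b)))))
    ... | inj₂ 1+y≡u = predecessor-covered left-covered (trans 1+y≡u u≡b) ,
                       ℕ.≤-trans (ℕ.n≤1+n _) (ℕ.≤-reflexive (trans 1+y≡u u≡b))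
    split : ∀ y → Between a (suc b) y → Between a b y ⊎ y ≡ v
    split y (a≤y , y≤1+b) with ℕ.m≤n⇒m<n∨m≡n y≤1+b
    ... | inj₁ y<1+b = inj₁ (a≤y , ℕ.≤-pred y<1+b)
    ... | inj₂ y≡1+b = inj₂ (Fin.toℕ-injective (trans y≡1+b (sym v≡1+b)))

  -- a ≡ 0 ⊎ a < b says that the left neighbour of b, if there is one, is blue as well.
  sweep-right : ∀ d {a b} → suc (b ℕ.+ d) ≡ n → a ℕ.≤ b → (a ≡ 0 ⊎ a ℕ.< b) →
                Reachᴾ (Between a b) → Reachᴾ (AtLeast a)
  sweep-right zero    {b = b} 1+b≡n a≤b _ reach = Reach-weaken (λ v a≤v → a≤v , v≤b v) reach
    where
    v≤b : ∀ v → toℕ v ℕ.≤ b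
    v≤b v = ℕ.≤-pred (subst (toℕ v ℕ.<_) (trans (sym 1+b≡n) (cong suc (ℕ.+-identityʳ b))) (Fin.toℕ<n v))
  sweep-right (suc d) {b = b} 1+b+d≡n a≤b left-covered reach =
    sweep-right d (trans (cong suc (sym (ℕ.+-suc b d))) 1+b+d≡n) (ℕ.m≤n⇒m≤1+n a≤b) (inj₂ (s≤s a≤b))
      (extend-right a≤b left-covered (subst (suc b ℕ.<_) 1+b+d≡n (s≤s (ℕ.m<m+n b (s≤s z≤n)))) reach)

  extend-left : ∀ {a} → suc a ℕ.< n → Reachᴾ (AtLeast (suc a)) → Reachᴾ (AtLeast a)
  extend-left {a} 1+a<n reach = Reach-weaken split
    (Reach-force u v (Adj-sym {G = Path n} {v} {u} (Path-adj⁺ (trans u≡1+a (cong suc (sym v≡a)))))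
                 (ℕ.≤-reflexive (sym u≡1+a)) others reach)
    where
    u v : Fin n
    u = fromℕ< 1+a<n
    v = fromℕ< (ℕ.<-trans (ℕ.n<1+n a) 1+a<n)
    u≡1+a : toℕ u ≡ suc a
    u≡1+a = Fin.toℕ-fromℕ< 1+a<n
    v≡a : toℕ v ≡ a
    v≡a = Fin.toℕ-fromℕ< _
    others : ∀ y → Adj (Path n) u y → y ≢ v → AtLeast (suc a) y
    others y u~y y≢v with Path-adj⁻ u~y
    ... | inj₁ y≡1+u = ℕ.≤-trans (ℕ.n≤1+n _) (ℕ.≤-reflexive (sym (trans y≡1+u (cong suc u≡1+a))))
    ... | inj₂ 1+y≡u = ⊥-elim (y≢v (Fin.toℕ-injective (trans (ℕ.suc-injective (trans 1+y≡u u≡1+a)) (sym v≡a))))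
    split : ∀ y → AtLeast a y → AtLeast (suc a) y ⊎ y ≡ v
    split y a≤y with ℕ.m≤n⇒m<n∨m≡n a≤y
    ... | inj₁ a<y = inj₁ a<y
    ... | inj₂ a≡y = inj₂ (Fin.toℕ-injective (trans (sym a≡y) (sym v≡a)))

  sweep-left : ∀ a → a ℕ.< n → Reachᴾ (AtLeast a) → Reachᴾ (AtLeast 0)
  sweep-left zero    _   reach = reach
  sweep-left (suc a) a<n reach = sweep-left a (ℕ.<-trans (ℕ.n<1+n a) a<n) (extend-left a<n reach)

  blue-suffix : FirstTrue B ⊎ Defectʳ B → ∃ λ a → a ℕ.< n × Reachᴾ (AtLeast a)
  blue-suffix (inj₁ (i , i≡0 , B[i])) with ℕ.m≤n⇒∃[o]m+o≡n (Fin.toℕ<n i)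
  ... | d , 1+i+d≡n = 0 , subst (ℕ._< n) i≡0 (Fin.toℕ<n i) ,
    sweep-right d (subst (λ k → suc (k ℕ.+ d) ≡ n) i≡0 1+i+d≡n) z≤n (inj₁ refl) (Reach-base (Between 0 0) blue)
    where
    blue : ∀ v → Between 0 0 v → lookup B v ≡ true
    blue v (_ , v≤0) = subst (λ x → lookup B x ≡ true) (Fin.toℕ-injective (trans i≡0 (sym (ℕ.n≤0⇒n≡0 v≤0)))) B[i]
  blue-suffix (inj₂ (inj₁ (i , 1+i≡n , B[i]))) = toℕ i , Fin.toℕ<n i , Reach-base (AtLeast (toℕ i)) blue
    where
    blue : ∀ v → AtLeast (toℕ i) v → lookup B v ≡ true
    blue v i≤v = subst (λ x → lookup B x ≡ true)
      (Fin.toℕ-injective (ℕ.≤-antisym i≤v (ℕ.≤-pred (subst (toℕ v ℕ.<_) (sym 1+i≡n) (Fin.toℕ<n v))))) B[i]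
  blue-suffix (inj₂ (inj₂ (i , j , j≡1+i , B[i] , B[j]))) with ℕ.m≤n⇒∃[o]m+o≡n (Fin.toℕ<n j)
  ... | d , 1+j+d≡n = toℕ i , Fin.toℕ<n i ,
    sweep-right d 1+j+d≡n (ℕ.<⇒≤ i<j) (inj₂ i<j) (Reach-base (Between (toℕ i) (toℕ j)) blue)
    where
    i<j : toℕ i ℕ.< toℕ j
    i<j = ℕ.≤-reflexive (sym j≡1+i)
    blue : ∀ v → Between (toℕ i) (toℕ j) v → lookup B v ≡ true
    blue v (i≤v , v≤j) with ℕ.m≤n⇒m<n∨m≡n v≤j
    ... | inj₂ v≡j = subst (λ x → lookup B x ≡ true) (Fin.toℕ-injective (sym v≡j)) B[j]
    ... | inj₁ v<j = subst (λ x → lookup B x ≡ true)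
                       (Fin.toℕ-injective (ℕ.≤-antisym i≤v (ℕ.≤-pred (subst (toℕ v ℕ.<_) j≡1+i v<j)))) B[i]

¬spacedˡʳ⇒IsZFS : ∀ {n} (B : Subset n) → spacedˡʳ B ≡ false → IsZFS (Path n) B
¬spacedˡʳ⇒IsZFS B h with PathForcing.blue-suffix B (¬spacedˡʳ⇒Defect B h)
... | a , a<n , reach with PathForcing.sweep-left B a a<n reach
... | B′ , steps , all-blue = B′ , steps , λ v → all-blue v z≤n

ℙ-ZFS-Path≥ : ∀ p → 0ℚ ≤ p → p ≤ 1ℚ → ∀ {n} χ → Indicates χ (IsZFS (Path n)) →
              1ℚ - Bernoulli.ℙ p n spacedˡʳ ≤ Bernoulli.ℙ p n χ
ℙ-ZFS-Path≥ p 0≤p p≤1 χ χ-ZFS =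
  Bernoulli.ℙ-cover p 0≤p p≤1 _ χ spacedˡʳ (λ B ¬spaced → proj₂ (χ-ZFS B) (¬spacedˡʳ⇒IsZFS B ¬spaced))

-- Degrees and pendant paths

neighbours : ∀ {n} → Graph n → Fin n → Subset n
neighbours G v = tabulate (adj G v)

Adj⇒∈neighbours : ∀ {n} {G : Graph n} {v y} → Adj G v y → y ∈ neighbours G v
Adj⇒∈neighbours {G = G} {v} {y} v~y =
  Vec.lookup⇒[]= y (neighbours G v) (trans (Vec.lookup∘tabulate (adj G v) y) v~y)

∣tabulate∣ : ∀ {n} (f : Fin n → Bool) → ∣ tabulate f ∣ ≡ sum (List.tabulate (λ u → if f u then 1 else 0))
∣tabulate∣ {zero}  f = refl
∣tabulate∣ {suc n} f with f Fin.zero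
... | true  = cong suc (∣tabulate∣ (f ∘ Fin.suc))
... | false = ∣tabulate∣ (f ∘ Fin.suc)

deg≡∣neighbours∣ : ∀ {n} (G : Graph n) v → deg G v ≡ ∣ neighbours G v ∣
deg≡∣neighbours∣ {n} G v =
  trans (cong sum (List.map-tabulate {n = n} id (λ u → if adj G v u then 1 else 0))) (sym (∣tabulate∣ (adj G v)))

1≤∣p∣ : ∀ {n} {p : Subset n} {x} → x ∈ p → 1 ℕ.≤ ∣ p ∣
1≤∣p∣ x∈p = ℕ.≤-trans (s≤s z≤n) (Subset.x∈p⇒∣p-x∣<∣p∣ x∈p)

2≤∣p∣ : ∀ {n} {p : Subset n} {x y} → x ≢ y → x ∈ p → y ∈ p → 2 ℕ.≤ ∣ p ∣
2≤∣p∣ x≢y x∈p y∈p =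
  ℕ.≤-trans (s≤s (1≤∣p∣ (Subset.x∈p∧x≢y⇒x∈p-y y∈p (x≢y ∘ sym)))) (Subset.x∈p⇒∣p-x∣<∣p∣ x∈p)

3≤∣p∣ : ∀ {n} {p : Subset n} {x y z} → x ≢ y → x ≢ z → y ≢ z → x ∈ p → y ∈ p → z ∈ p → 3 ℕ.≤ ∣ p ∣
3≤∣p∣ x≢y x≢z y≢z x∈p y∈p z∈p = ℕ.≤-trans
  (s≤s (2≤∣p∣ x≢y (Subset.x∈p∧x≢y⇒x∈p-y x∈p x≢z) (Subset.x∈p∧x≢y⇒x∈p-y y∈p y≢z)))
  (Subset.x∈p⇒∣p-x∣<∣p∣ z∈p)

deg≡1⇒unique-neighbour : ∀ {n} {G : Graph n} {v x y} → deg G v ≡ 1 → Adj G v x → Adj G v y → y ≡ x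
deg≡1⇒unique-neighbour {G = G} {v} {x} {y} deg≡1 v~x v~y with y Fin.≟ x
... | yes y≡x = y≡x
... | no  y≢x = ⊥-elim (ℕ.<-irrefl refl (subst (2 ℕ.≤_) (trans (sym (deg≡∣neighbours∣ G v)) deg≡1)
                  (2≤∣p∣ y≢x (Adj⇒∈neighbours {G = G} v~y) (Adj⇒∈neighbours {G = G} v~x))))

deg≡2⇒two-neighbours : ∀ {n} {G : Graph n} {v x y z} → deg G v ≡ 2 → x ≢ y →
                       Adj G v x → Adj G v y → Adj G v z → z ≡ x ⊎ z ≡ y
deg≡2⇒two-neighbours {G = G} {v} {x} {y} {z} deg≡2 x≢y v~x v~y v~z with z Fin.≟ x | z Fin.≟ y
... | yes z≡x | _       = inj₁ z≡x
... | no  _   | yes z≡y = inj₂ z≡y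
... | no  z≢x | no  z≢y = ⊥-elim (ℕ.<-irrefl refl (subst (3 ℕ.≤_) (trans (sym (deg≡∣neighbours∣ G v)) deg≡2)
    (3≤∣p∣ x≢y (z≢x ∘ sym) (z≢y ∘ sym) (Adj⇒∈neighbours {G = G} v~x) (Adj⇒∈neighbours {G = G} v~y)
                                        (Adj⇒∈neighbours {G = G} v~z))))

module PendantPath {n} {G : Graph n} {s} {u : Fin (suc s) → Fin n} (pp : IsPendantPath G (suc s) u)
                   {w} (anchor : IsAnchor u w) where
  open IsPendantPath pp

  legColours : Subset n → Subset s
  legColours = restrict (u ∘ Fin.inject₁)

  private
    index : ∀ {k} → k ℕ.< suc s → ∃ λ (j : Fin (suc s)) → toℕ j ≡ k
    index k<1+s = fromℕ< k<1+s , Fin.toℕ-fromℕ< k<1+s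

    u-<⇒≢ : ∀ {i j} → toℕ i ℕ.< toℕ j → u i ≢ u j
    u-<⇒≢ i<j ui≡uj = ℕ.<⇒≢ i<j (cong toℕ (distinct ui≡uj))

    anchor-index : ∃ λ (ℓ : Fin (suc s)) → toℕ ℓ ≡ s × u ℓ ≡ w
    anchor-index = fromℕ< (ℕ.n<1+n s) , Fin.toℕ-fromℕ< (ℕ.n<1+n s) ,
                   anchor _ (cong suc (Fin.toℕ-fromℕ< (ℕ.n<1+n s)))

    inject₁-fromℕ< : ∀ {i : Fin (suc s)} (i<s : toℕ i ℕ.< s) → Fin.inject₁ (fromℕ< i<s) ≡ i
    inject₁-fromℕ< i<s = Fin.toℕ-injective (trans (Fin.toℕ-inject₁ (fromℕ< i<s)) (Fin.toℕ-fromℕ< i<s))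

    lookup-legColours : ∀ B (i : Fin s) → lookup (legColours B) i ≡ lookup B (u (Fin.inject₁ i))
    lookup-legColours B i = Vec.lookup∘tabulate (lookup B ∘ u ∘ Fin.inject₁) i

    white⇒∉ : ∀ {B : Subset n} {x} → lookup B x ≡ false → x ∉ B
    white⇒∉ B[x]≡false x∈B with trans (sym (Vec.[]=⇒lookup x∈B)) B[x]≡false
    ... | ()

  leg-neighbour : ∀ {i y} → toℕ i ℕ.< s → Adj G (u i) y →
                  ∃ λ j → (toℕ j ≡ suc (toℕ i) ⊎ suc (toℕ j) ≡ toℕ i) × y ≡ u j
  leg-neighbour {i} {y} i<s ui~y = by-position (toℕ i) refl
    where
    j⁺ : Fin (suc s)
    j⁺ = fromℕ< (s≤s i<s)
    j⁺≡1+i : toℕ j⁺ ≡ suc (toℕ i)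
    j⁺≡1+i = Fin.toℕ-fromℕ< (s≤s i<s)
    ui~uj⁺ : Adj G (u i) (u j⁺)
    ui~uj⁺ = consec i j⁺ j⁺≡1+i
    by-position : ∀ k → toℕ i ≡ k → ∃ λ j → (toℕ j ≡ suc (toℕ i) ⊎ suc (toℕ j) ≡ toℕ i) × y ≡ u j
    by-position zero    i≡0   = j⁺ , inj₁ j⁺≡1+i , deg≡1⇒unique-neighbour {G = G} (first i i≡0) ui~uj⁺ ui~y
    by-position (suc k) i≡1+k with index {k} (ℕ.m<n⇒m<1+n (ℕ.<-trans (ℕ.n<1+n k) (subst (ℕ._< s) i≡1+k i<s)))
    ... | j⁻ , j⁻≡k with deg≡2⇒two-neighbours {G = G} (interior i (subst (0 ℕ.<_) (sym i≡1+k) (s≤s z≤n)) (s≤s i<s))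
                           (u-<⇒≢ j⁻<j⁺ ∘ sym) ui~uj⁺
                           (Adj-sym {G = G} (consec j⁻ i (trans i≡1+k (cong suc (sym j⁻≡k))))) ui~y
      where
      j⁻<j⁺ : toℕ j⁻ ℕ.< toℕ j⁺
      j⁻<j⁺ = subst₂ ℕ._<_ (sym j⁻≡k) (sym (trans j⁺≡1+i (cong suc i≡1+k)))
                (ℕ.<-trans (ℕ.n<1+n k) (ℕ.n<1+n (suc k)))
    ... | inj₁ y≡uj⁺ = j⁺ , inj₁ j⁺≡1+i , y≡uj⁺
    ... | inj₂ y≡uj⁻ = j⁻ , inj₂ (trans (cong suc j⁻≡k) (sym i≡1+k)) , y≡uj⁻

  leg-vertex≢anchor : ∀ {i} → toℕ i ℕ.< s → u i ≢ w
  leg-vertex≢anchor i<s ui≡w with anchor-index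
  ... | ℓ , ℓ≡s , uℓ≡w = ℕ.<⇒≢ i<s (trans (cong toℕ (distinct (trans ui≡w (sym uℓ≡w)))) ℓ≡s)

  anchor-adjacent : ∃ λ j → suc (toℕ j) ≡ s × Adj G w (u j)
  anchor-adjacent with ℕ.m≤n⇒∃[o]m+o≡n (ℕ.≤-pred two≤k) | anchor-index
  ... | d , 1+d≡s | ℓ , ℓ≡s , uℓ≡w =
    j , 1+j≡s , Adj-sym {G = G} (subst (Adj G (u j)) uℓ≡w (consec j ℓ (trans ℓ≡s (sym 1+j≡s))))
    where
    j : Fin (suc s)
    j = fromℕ< (ℕ.m<n⇒m<1+n (subst (d ℕ.<_) 1+d≡s ℕ.≤-refl))
    1+j≡s : suc (toℕ j) ≡ s
    1+j≡s = trans (cong suc (Fin.toℕ-fromℕ< _)) 1+d≡s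

  Frozen : Subset n → Subset n → Set
  Frozen B X = ∀ i → toℕ i ℕ.< s → u i ∈ X → u i ∈ B

  module _ {B : Subset n} (spaced-leg : spacedˡʳ (legColours B) ≡ true) where

    blue-leg-vertex-isolated : ∀ {j} → toℕ j ℕ.< s → u j ∈ B →
      ∃ λ a → ∃ λ b → suc (toℕ a) ≡ toℕ j × toℕ b ≡ suc (toℕ j) × toℕ b ℕ.< s × u a ∉ B × u b ∉ B
    blue-leg-vertex-isolated {j} j<s uj∈B
      with spacedˡʳ⇒isolated (legColours B) spaced-leg (fromℕ< j<s)
             (trans (lookup-legColours B (fromℕ< j<s))
                    (trans (cong (lookup B ∘ u) (inject₁-fromℕ< j<s)) (Vec.[]=⇒lookup uj∈B)))
    ... | k⁻ , k⁺ , below , above , B[k⁻] , B[k⁺] =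
      Fin.inject₁ k⁻ , Fin.inject₁ k⁺ ,
      trans (cong suc (Fin.toℕ-inject₁ k⁻)) (trans below (Fin.toℕ-fromℕ< j<s)) ,
      trans (Fin.toℕ-inject₁ k⁺) (trans above (cong suc (Fin.toℕ-fromℕ< j<s))) ,
      subst (ℕ._< s) (sym (Fin.toℕ-inject₁ k⁺)) (Fin.toℕ<n k⁺) ,
      white⇒∉ (trans (sym (lookup-legColours B k⁻)) B[k⁻]) ,
      white⇒∉ (trans (sym (lookup-legColours B k⁺)) B[k⁺])

    anchor-adjacent-white : ∀ {j} → suc (toℕ j) ≡ s → u j ∉ B
    anchor-adjacent-white {j} 1+j≡s uj∈B
      with blue-leg-vertex-isolated (subst (toℕ j ℕ.<_) 1+j≡s (ℕ.n<1+n _)) uj∈B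
    ... | _ , b , _ , b≡1+j , b<s , _ = ℕ.<-irrefl (trans b≡1+j 1+j≡s) b<s

    -- A vertex adjacent to a leg vertex is either w, which also sees the white vertex o off
    -- the leg, or a blue leg vertex, whose two leg neighbours are white.
    leg-vertex-never-forced : ∀ {X : Subset n} → Frozen B X →
      ∀ {o} → Adj G w o → o ∉ X → (∀ i → toℕ i ℕ.< s → o ≢ u i) →
      ∀ {z i} → z ∈ X → toℕ i ℕ.< s → Adj G z (u i) → ¬ (∀ y → Adj G z y → y ≢ u i → y ∈ X)
    leg-vertex-never-forced {X} frozen {o} w~o o∉X o-off-leg {z} {i} z∈X i<s z~ui others
      with leg-neighbour i<s (Adj-sym {G = G} z~ui)
    ... | j , _ , z≡uj with ℕ.m≤n⇒m<n∨m≡n (ℕ.≤-pred (Fin.toℕ<n j))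
    ...   | inj₂ j≡s =
      o∉X (others o (subst (λ x → Adj G x o) (sym (trans z≡uj (anchor j (cong suc j≡s)))) w~o) (o-off-leg i i<s))
    ...   | inj₁ j<s with blue-leg-vertex-isolated j<s (frozen j j<s (subst (_∈ X) z≡uj z∈X))
    ...     | a , b , 1+a≡j , b≡1+j , b<s , ua∉B , ub∉B =
      two-white-neighbours⇒¬force {G = G} (u-<⇒≢ a<b)
        (subst (λ x → Adj G x (u a)) (sym z≡uj) (Adj-sym {G = G} (consec a j (sym 1+a≡j))))
        (subst (λ x → Adj G x (u b)) (sym z≡uj) (consec j b b≡1+j))
        (ua∉B ∘ frozen a (ℕ.<-trans a<j j<s))
        (ub∉B ∘ frozen b b<s)
        others
      where
      a<j : toℕ a ℕ.< toℕ j
      a<j = subst (toℕ a ℕ.<_) 1+a≡j ℕ.≤-refl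
      a<b : toℕ a ℕ.< toℕ b
      a<b = subst (toℕ a ℕ.<_) (sym b≡1+j) (ℕ.<-trans a<j (ℕ.n<1+n (toℕ j)))

    leg-stays-frozen : ∀ {X X′ : Subset n} → Frozen B X →
      ∀ {o} → Adj G w o → o ∉ X → (∀ i → toℕ i ℕ.< s → o ≢ u i) →
      Force G X X′ → Frozen B X′
    leg-stays-frozen {X} frozen w~o o∉X o-off-leg (force z x z∈X _ z~x others) i i<s ui∈X′
      with Subset.x∈p∪q⁻ X ⁅ x ⁆ ui∈X′
    ... | inj₁ ui∈X  = frozen i i<s ui∈X
    ... | inj₂ ui∈⁅x⁆ with Subset.x∈⁅y⁆⇒x≡y x ui∈⁅x⁆
    ... | refl = ⊥-elim (leg-vertex-never-forced frozen w~o o∉X o-off-leg z∈X i<s z~x others)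

module TwoPendantPaths {n} {G : Graph n} {s t w} {u : Fin (suc s) → Fin n} {v : Fin (suc t) → Fin n}
  (ppu : IsPendantPath G (suc s) u) (ancu : IsAnchor u w) (ppv : IsPendantPath G (suc t) v) (ancv : IsAnchor v w)
  (u∩v⊆w : ∀ i j → u i ≡ v j → u i ≡ w) where

  module U = PendantPath ppu ancu
  module V = PendantPath ppv ancv

  legs-spaced : Subset n → Bool
  legs-spaced B = spacedˡʳ (U.legColours B) ∧ spacedˡʳ (V.legColours B)

  legs-spaced⇒¬IsZFS : ∀ B → legs-spaced B ≡ true → ¬ IsZFS G B
  legs-spaced⇒¬IsZFS B both-spaced (B′ , steps , all-blue) = U.anchor-adjacent-white spaced-u 1+jᵤ≡s
    (proj₁ (stays-frozen steps ((λ _ _ → id) , (λ _ _ → id))) jᵤ jᵤ<s (all-blue (u jᵤ)))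
    where
    spaced-u : spacedˡʳ (U.legColours B) ≡ true
    spaced-u = Bool.∧-conicalˡ _ _ both-spaced
    spaced-v : spacedˡʳ (V.legColours B) ≡ true
    spaced-v = Bool.∧-conicalʳ _ _ both-spaced
    jᵤ : Fin (suc s)
    jᵤ = proj₁ U.anchor-adjacent
    1+jᵤ≡s : suc (toℕ jᵤ) ≡ s
    1+jᵤ≡s = proj₁ (proj₂ U.anchor-adjacent)
    jᵤ<s : toℕ jᵤ ℕ.< s
    jᵤ<s = subst (toℕ jᵤ ℕ.<_) 1+jᵤ≡s ℕ.≤-refl
    jᵥ : Fin (suc t)
    jᵥ = proj₁ V.anchor-adjacent
    1+jᵥ≡t : suc (toℕ jᵥ) ≡ t
    1+jᵥ≡t = proj₁ (proj₂ V.anchor-adjacent)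
    jᵥ<t : toℕ jᵥ ℕ.< t
    jᵥ<t = subst (toℕ jᵥ ℕ.<_) 1+jᵥ≡t ℕ.≤-refl
    Frozen : Subset n → Set
    Frozen X = U.Frozen B X × V.Frozen B X
    step : ∀ {X X′} → Frozen X → Force G X X′ → Frozen X′
    step (frozen-u , frozen-v) f =
      U.leg-stays-frozen spaced-u frozen-u (proj₂ (proj₂ V.anchor-adjacent))
        (V.anchor-adjacent-white spaced-v 1+jᵥ≡t ∘ frozen-v jᵥ jᵥ<t)
        (λ i i<s vjᵥ≡ui → U.leg-vertex≢anchor i<s (u∩v⊆w i jᵥ (sym vjᵥ≡ui))) f ,
      V.leg-stays-frozen spaced-v frozen-v (proj₂ (proj₂ U.anchor-adjacent))
        (U.anchor-adjacent-white spaced-u 1+jᵤ≡s ∘ frozen-u jᵤ jᵤ<s)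
        (λ j j<t ujᵤ≡vj → U.leg-vertex≢anchor jᵤ<s (u∩v⊆w jᵤ j ujᵤ≡vj)) f
    stays-frozen : ∀ {X X′} → Star (Force G) X X′ → Frozen X → Frozen X′
    stays-frozen ε        frozen = frozen
    stays-frozen (f ◅ fs) frozen = stays-frozen fs (step frozen f)

  module _ (p : ℚ) where
    open Bernoulli p

    ℙ-legs-spaced : ℙ n legs-spaced ≡ ℙ s spacedˡʳ * ℙ t spacedˡʳ
    ℙ-legs-spaced = trans (𝔼-cong n (λ B → 𝟙-∧ (spacedˡʳ (U.legColours B)) (spacedˡʳ (V.legColours B))))
      (𝔼-independent (u ∘ Fin.inject₁) (v ∘ Fin.inject₁) (leg-injective ppu) (leg-injective ppv) legs-disjoint
        (𝟙 ∘ spacedˡʳ) (𝟙 ∘ spacedˡʳ))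
      where
      leg-injective : ∀ {r} {x : Fin (suc r) → Fin n} → IsPendantPath G (suc r) x →
                      Injective _≡_ _≡_ (x ∘ Fin.inject₁)
      leg-injective pp = Fin.inject₁-injective ∘ IsPendantPath.distinct pp
      legs-disjoint : ∀ i j → u (Fin.inject₁ i) ≢ v (Fin.inject₁ j)
      legs-disjoint i j ui≡vj =
        U.leg-vertex≢anchor (subst (ℕ._< s) (sym (Fin.toℕ-inject₁ i)) (Fin.toℕ<n i)) (u∩v⊆w _ _ ui≡vj)

    ℙ-ZFS≤ : 0ℚ ≤ p → p ≤ 1ℚ → ∀ χ → Indicates χ (IsZFS G) → ℙ n χ ≤ 1ℚ - ℙ s spacedˡʳ * ℙ t spacedˡʳ
    ℙ-ZFS≤ 0≤p p≤1 χ χ-ZFS = subst (λ x → ℙ n χ ≤ 1ℚ - x) ℙ-legs-spaced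
      (ℙ-disjoint 0≤p p≤1 n χ legs-spaced
        (λ B χ[B] spaced → legs-spaced⇒¬IsZFS B spaced (proj₁ (χ-ZFS B) χ[B])))

lemma5p2 : (n s t : ℕ) (G : Graph n) (w : Fin n)
    (u : Fin (suc s) → Fin n) (v : Fin (suc t) → Fin n) →
    IsPendantPath G (suc s) u → IsAnchor u w →
    IsPendantPath G (suc t) v → IsAnchor v w →
    (∀ i j → u i ≡ v j → u i ≡ w) →
    s ℕ.+ t ℕ.+ 14 ℕ.≤ n →
    (p : ℚ) → 8/ (n ∸ (s ℕ.+ t)) ≤ p → p < 1ℚ →
    (χG χP : Subset n → Bool) →
    Indicates χG (IsZFS G) → Indicates χP (IsZFS (Path n)) →
    ProbOf n χG p < ProbOf n χP p
lemma5p2 n s t G w u v ppu ancu ppv ancv u∩v⊆w s+t+14≤n p 8/[n-s-t]≤p p<1 χG χP χG-ZFS χP-ZFS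
  with ℕ.m≤n⇒∃[o]m+o≡n s+t+14≤n
... | k , refl = begin-strict
  ProbOf N χG p                      ≡⟨ ProbOf≡ℙ N χG ⟩
  ℙ N χG                             ≤⟨ ℙ-ZFS≤ p 0≤p p≤1 χG χG-ZFS ⟩
  1ℚ - ℙ s spacedˡʳ * ℙ t spacedˡʳ   <⟨ ℚ.+-monoʳ-< 1ℚ (ℚ.neg-antimono-< gap) ⟩
  1ℚ - ℙ N spacedˡʳ                  ≤⟨ ℙ-ZFS-Path≥ p 0≤p p≤1 χP χP-ZFS ⟩
  ℙ N χP                             ≡⟨ ProbOf≡ℙ N χP ⟨
  ProbOf N χP p                      ∎
  where
  N : ℕ
  N = s ℕ.+ t ℕ.+ 14 ℕ.+ k
  N∸[s+t]≡14+k : N ∸ (s ℕ.+ t) ≡ 14 ℕ.+ k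
  N∸[s+t]≡14+k = trans (cong (_∸ (s ℕ.+ t)) (ℕ.+-assoc (s ℕ.+ t) 14 k)) (ℕ.m+n∸m≡n (s ℕ.+ t) (14 ℕ.+ k))
  bounds : 0ℚ < p × ι 8 ≤ ι (14 ℕ.+ k) * p
  bounds = 8/-lower-bound (13 ℕ.+ k) (subst (λ m → 8/ m ≤ p) N∸[s+t]≡14+k 8/[n-s-t]≤p)
  0<p : 0ℚ < p
  0<p = proj₁ bounds
  8≤[14+k]p : ι 8 ≤ ι (14 ℕ.+ k) * p
  8≤[14+k]p = proj₂ bounds
  0≤p : 0ℚ ≤ p
  0≤p = ℚ.<⇒≤ 0<p
  p≤1 : p ≤ 1ℚ
  p≤1 = ℚ.<⇒≤ p<1
  open ℚ.≤-Reasoning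
  open Bernoulli p
  open SpacedProbabilities p 0≤p p<1
  open TwoPendantPaths ppu ancu ppv ancv u∩v⊆w
  gap : ℙ N spacedˡʳ < ℙ s spacedˡʳ * ℙ t spacedˡʳ
  gap = ℙ-spacedˡʳ-gap 0<p k (ℕ.≤-pred (IsPendantPath.two≤k ppu)) (ℕ.≤-pred (IsPendantPath.two≤k ppv)) 8≤[14+k]p
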